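{- Let $q$ be a power of a prime $p$, $A=\mathbb{F}_q[t]$, and for $s\in\mathbb{Z}$ let $S_1(s)=\sum_{a\in A_{1+}} a^{ -s}\in \mathbb{F}_q(t)$, where $A_{1+}$ is the set of monic polynomials of degree $1$ in $A$. Given $a,b\in\mathbb{Z}_+$, there exist finitely many $f_i\in\mathbb{F}_p$ and $a_i\in\mathbb{Z}_+$ such that $$S_1(a)S_1(b)-S_1(a+b)=\sum_i f_i S_1(a_i).$$ Moreover, the $a_i$ can be chosen so that $a+b-a_i$ is a multiple of $q-1$ for every $i$.
   Context: $\mathbb{Z}_+$ denotes the positive integers; $\mathbb{F}_q$ is the finite field with $q$ elements and $t$ an indeterminate. -}

module Defs where

open import Level using (_⊔_)
open import Algebra.Bundles using (CommutativeRing)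
open import Data.Nat using (ℕ; zero; suc)
open import Data.Fin using (Fin)
open import Data.List using (List; []; _∷_)
open import Data.Product using (∃; _×_; _,_)
open import Relation.Binary.PropositionalEquality using (_≡_)
open import Relation.Nullary using (¬_)

module _ {c ℓ} (R : CommutativeRing c ℓ) where
  open CommutativeRing R

  natMul : ℕ → Carrier → Carrier
  natMul zero    x = 0#
  natMul (suc n) x = x + natMul n x

  record IsFiniteField (q : ℕ) : Set (c ⊔ ℓ) where
    field
      one≉zero  : ¬ (1# ≈ 0#)
      inverse   : ∀ x → ¬ (x ≈ 0#) → ∃ λ y → x * y ≈ 1#
      enum      : Fin q → Carrier
      enum-inj  : ∀ i j → enum i ≈ enum j → i ≡ j
      enum-surj : ∀ x → ∃ λ i → enum i ≈ x

  -- Polynomials R[t] as coefficient lists (constant term first)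

  Poly : Set c
  Poly = List Carrier

  coeff : Poly → ℕ → Carrier
  coeff []       _       = 0#
  coeff (a ∷ f)  zero    = a
  coeff (a ∷ f)  (suc n) = coeff f n

  -- equality of polynomials: all coefficients agree (trailing zeros irrelevant)
  _≈ₚ_ : Poly → Poly → Set ℓ
  f ≈ₚ g = ∀ n → coeff f n ≈ coeff g n

  _+ₚ_ : Poly → Poly → Poly
  []      +ₚ g       = g
  (a ∷ f) +ₚ []      = a ∷ f
  (a ∷ f) +ₚ (b ∷ g) = (a + b) ∷ (f +ₚ g)

  scaleₚ : Carrier → Poly → Poly
  scaleₚ a []      = []
  scaleₚ a (b ∷ f) = (a * b) ∷ scaleₚ a f

  _*ₚ_ : Poly → Poly → Poly
  []      *ₚ g = []
  (a ∷ f) *ₚ g = scaleₚ a g +ₚ (0# ∷ (f *ₚ g))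

  oneₚ : Poly
  oneₚ = 1# ∷ []

  _^ₚ_ : Poly → ℕ → Poly
  f ^ₚ zero  = oneₚ
  f ^ₚ suc n = f *ₚ (f ^ₚ n)

  tPlus : Carrier → Poly
  tPlus θ = θ ∷ 1# ∷ []

  -- Rational functions R(t) as fractions num / den (den ≠ 0 in all uses
  -- below, since denominators are products of monic polynomials)

  Frac : Set c
  Frac = Poly × Poly

  _≈f_ : Frac → Frac → Set ℓ
  (n₁ , d₁) ≈f (n₂ , d₂) = (n₁ *ₚ d₂) ≈ₚ (n₂ *ₚ d₁)

  _+f_ : Frac → Frac → Frac
  (n₁ , d₁) +f (n₂ , d₂) = ((n₁ *ₚ d₂) +ₚ (n₂ *ₚ d₁)) , (d₁ *ₚ d₂)

  _*f_ : Frac → Frac → Frac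
  (n₁ , d₁) *f (n₂ , d₂) = (n₁ *ₚ n₂) , (d₁ *ₚ d₂)

  -_f : Frac → Frac
  -_f (n , d) = scaleₚ (- 1#) n , d

  zeroF : Frac
  zeroF = [] , oneₚ

  natMulF : ℕ → Frac → Frac
  natMulF zero    x = zeroF
  natMulF (suc m) x = x +f natMulF m x

  sumFin : ∀ {q} → (Fin q → Frac) → Frac
  sumFin {zero}  f = zeroF
  sumFin {suc q} f = f Fin.zero +f sumFin {q} (λ i → f (Fin.suc i))
    where import Data.Fin as Fin

  -- S₁(s) = Σ_{a ∈ A_{1+}} a^{-s} = Σ_{θ ∈ F_q} 1 / (t + θ)^s
  S₁ : ∀ {q} → (Fin q → Carrier) → ℕ → Frac
  S₁ enum s = sumFin (λ i → oneₚ , (tPlus (enum i) ^ₚ s))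

  -- Σ_i f_i S₁(a_i) for a list of pairs (f_i , a_i), f_i a natural number
  -- acting through the prime field
  linComb : ∀ {q} → (Fin q → Carrier) → List (ℕ × ℕ) → Frac
  linComb enum []             = zeroF
  linComb enum ((f , a) ∷ xs) = natMulF f (S₁ enum a) +f linComb enum xs

module Submission where

-- With u_θ = 1/(t + θ) everything rests on the relation u_x - u_y = (y - x) u_x u_y.
--  * PartialFractions: in characteristic p, u - v = c u v implies
--      c^(a+b) u^a v^b = Σ_{k<a+b} c^(k+1) (A_k u^(k+1) + B_k v^(k+1))   (A_k, B_k ∈ ℕ).
--  * FiniteField: Σ_{x ∈ F_q} x^m is -1 when m ≥ 1 and (q - 1) ∣ m, and 0 otherwise
--    (Fermat's little theorem and the root bound for polynomial functions).
--  * ProductFormula: S(a) S(b) - S(a+b) = Σ_{x ≠ y} u_x^a u_y^b.  Each term is multiplied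
--    by (y - x)^((q-2)(a+b)) (y - x)^(a+b) = 1 and expanded by partial fractions; summing
--    over x and y turns the powers (y - x)^m into power sums, which leaves
--    -(A_k + B_k) S(k+1) for exactly those k with k + 1 ≡ a + b modulo q - 1.  This is
--    proved in any commutative ring receiving F_q with elements u_x obeying the relation.
--  * Polynomials, Fractions, RationalFunctions: coefficient lists over R and fractions with
--    regular denominators form commutative rings, in which t + θ is regular and the u_θ
--    obey the relation.  mainTheorem1 instantiates ProductFormula there and reads the
--    identity back in the fraction notation of the statement.

-- Defs' negation -_f is renamed, since as a mixfix operator it would also parse - x … f
open import Defs renaming (-_f to negᶠ)
open import Level using (_⊔_)
open import Algebra.Bundles using (CommutativeRing; CommutativeMonoid)
open import Algebra.Morphism.Structures using (module RingMorphisms)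
open RingMorphisms using (IsRingHomomorphism)
open import Algebra.Morphism.Construct.Composition using (isRingHomomorphism)
import Algebra.Properties.CommutativeMonoid.Sum as CommutativeMonoidSum
open import Data.Nat as ℕ using (ℕ; zero; suc; _≤_; _<_; s≤s; z≤n; NonZero; _∸_)
open import Data.Nat.Properties as ℕ using ()
open import Data.Nat.DivMod using (_%_; _/_; m≡m%n+[m/n]*n; m%n<n)
open import Data.Nat.Divisibility using (_∣_; _∣?_; divides; m%n≡0⇒n∣m)
open import Data.Nat.Primality using (Prime; prime⇒nonZero; prime⇒nonTrivial)
open import Data.Integer as ℤ using (ℤ; +_; -[1+_]; _⊖_) renaming (_-_ to _-ℤ_)
open import Data.Integer.Properties using ([1+m]⊖[1+n]≡m⊖n; pos-+; pos-*; m-n≡m⊖n; ⊖-≥)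
open import Data.Integer.Divisibility using () renaming (_∣_ to _∣ℤ_)
open import Data.Integer.Divisibility.Signed using (∣ᵤ⇒∣; ∣⇒∣ᵤ; ∣-refl; ∣m⇒∣m*n; ∣m∣n⇒∣m-n)
  renaming (_∣_ to _∣ₛ_)
open import Data.Integer.Solver using (module +-*-Solver)
open import Data.Sign as Sign using (Sign)
open import Data.Maybe using (Maybe; just; nothing)
open import Data.Fin using (Fin; zero; suc; punchIn)
open import Data.Fin.Properties using (punchIn-injective; punchInᵢ≢i; ¬∀⟶∃¬; suc-injective) renaming (_≟_ to _≟ᶠ_)
open import Data.Fin.Permutation using (Permutation; permutation)
open import Data.List using (List; []; _∷_; length)
open import Data.List.Relation.Unary.All using (All; []; _∷_)
open import Data.Product using (Σ; ∃; _×_; _,_; proj₁; proj₂)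
open import Data.Sum using (_⊎_; inj₁; inj₂)
open import Function using (_∘_)
open import Relation.Nullary using (¬_; Dec; yes; no)
open import Relation.Nullary.Negation using (contradiction)
open import Relation.Binary.PropositionalEquality as ≡ using (_≡_; _≢_)

-- The canonical map ℤ → R into any commutative ring R is a ring morphism.
-- Plugging it into the standard-library ring solver gives a solver for
-- identities with integer coefficients (so with subtraction) in R.
module IntegerSolver {c ℓ} (R : CommutativeRing c ℓ) where
  open CommutativeRing R
  open import Relation.Binary.Reasoning.Setoid setoid
  open import Algebra.Definitions.RawMonoid +-rawMonoid using () renaming (_×_ to _·_)
  open import Algebra.Properties.Monoid.Mult +-monoid using (×-homo-+)
  open import Algebra.Properties.Semiring.Mult semiring using (×1-homo-*)
  open import Algebra.Properties.Ring ring
    using (-‿involutive; -‿distribˡ-*; -‿distribʳ-*; -0#≈0#)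
  open import Algebra.Properties.AbelianGroup +-abelianGroup using (⁻¹-∙-comm)
  open import Algebra.Properties.CommutativeSemigroup +-commutativeSemigroup using (interchange)
  open import Algebra.Properties.CommutativeSemigroup *-commutativeSemigroup using () renaming (interchange to interchange*)
  open import Algebra.Solver.Ring.AlmostCommutativeRing
    using (fromCommutativeRing; _-Raw-AlmostCommutative⟶_)
  import Algebra.Solver.Ring as RingSolver

  ⟦_⟧ : ℤ → Carrier
  ⟦ + n ⟧      = n · 1#
  ⟦ -[1+ n ] ⟧ = - (suc n · 1#)

  ⟦_⟧ₛ : Sign → Carrier
  ⟦ Sign.+ ⟧ₛ = 1#
  ⟦ Sign.- ⟧ₛ = - 1#

  cancel-1 : ∀ a b → (1# + a) - (1# + b) ≈ a - b
  cancel-1 a b = begin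
    (1# + a) - (1# + b)     ≈⟨ +-congˡ (⁻¹-∙-comm 1# b) ⟨
    (1# + a) + (- 1# - b)   ≈⟨ interchange 1# a (- 1#) (- b) ⟩
    (1# - 1#) + (a - b)     ≈⟨ +-congʳ (-‿inverseʳ 1#) ⟩
    0# + (a - b)            ≈⟨ +-identityˡ _ ⟩
    a - b                   ∎

  ⊖-homo : ∀ m n → ⟦ m ⊖ n ⟧ ≈ m · 1# - n · 1#
  ⊖-homo zero    zero    = sym (-‿inverseʳ 0#)
  ⊖-homo zero    (suc n) = sym (+-identityˡ _)
  ⊖-homo (suc m) zero    = sym (trans (+-congˡ -0#≈0#) (+-identityʳ _))
  ⊖-homo (suc m) (suc n) = begin
    ⟦ suc m ⊖ suc n ⟧                   ≡⟨ ≡.cong ⟦_⟧ ([1+m]⊖[1+n]≡m⊖n m n) ⟩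
    ⟦ m ⊖ n ⟧                           ≈⟨ ⊖-homo m n ⟩
    m · 1# - n · 1#                     ≈⟨ cancel-1 (m · 1#) (n · 1#) ⟨
    suc m · 1# - suc n · 1#             ∎

  ◃-homo : ∀ s n → ⟦ s ℤ.◃ n ⟧ ≈ ⟦ s ⟧ₛ * n · 1#
  ◃-homo s       zero    = sym (zeroʳ _)
  ◃-homo Sign.+ (suc n) = sym (*-identityˡ _)
  ◃-homo Sign.- (suc n) = trans (-‿cong (sym (*-identityˡ _))) (-‿distribˡ-* 1# _)

  sign-abs : ∀ i → ⟦ i ⟧ ≈ ⟦ ℤ.sign i ⟧ₛ * ℤ.∣ i ∣ · 1#
  sign-abs (+ n)      = sym (*-identityˡ _)
  sign-abs -[1+ n ]   = ◃-homo Sign.- (suc n)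

  sign-*-homo : ∀ s t → ⟦ s Sign.* t ⟧ₛ ≈ ⟦ s ⟧ₛ * ⟦ t ⟧ₛ
  sign-*-homo Sign.+ t      = sym (*-identityˡ _)
  sign-*-homo Sign.- Sign.+ = sym (*-identityʳ _)
  sign-*-homo Sign.- Sign.- = begin
    1#              ≈⟨ -‿involutive 1# ⟨
    - (- 1#)        ≈⟨ -‿cong (*-identityʳ _) ⟨
    - (- 1# * 1#)   ≈⟨ -‿distribʳ-* (- 1#) 1# ⟩
    - 1# * - 1#     ∎

  *-homo : ∀ i j → ⟦ i ℤ.* j ⟧ ≈ ⟦ i ⟧ * ⟦ j ⟧
  *-homo i j = begin
    ⟦ (s Sign.* t) ℤ.◃ (m ℕ.* n) ⟧            ≈⟨ ◃-homo (s Sign.* t) (m ℕ.* n) ⟩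
    ⟦ s Sign.* t ⟧ₛ * (m ℕ.* n) · 1#           ≈⟨ *-cong (sign-*-homo s t) (×1-homo-* m n) ⟩
    (⟦ s ⟧ₛ * ⟦ t ⟧ₛ) * (m · 1# * n · 1#)      ≈⟨ interchange* _ _ _ _ ⟩
    (⟦ s ⟧ₛ * m · 1#) * (⟦ t ⟧ₛ * n · 1#)      ≈⟨ *-cong (sign-abs i) (sign-abs j) ⟨
    ⟦ i ⟧ * ⟦ j ⟧                              ∎
    where
    s t : Sign
    s = ℤ.sign i
    t = ℤ.sign j
    m n : ℕ
    m = ℤ.∣ i ∣
    n = ℤ.∣ j ∣

  -‿homo : ∀ i → ⟦ ℤ.- i ⟧ ≈ - ⟦ i ⟧
  -‿homo (+ zero)  = sym -0#≈0#
  -‿homo (+ suc n) = refl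
  -‿homo -[1+ n ]  = sym (-‿involutive _)

  +-homo : ∀ i j → ⟦ i ℤ.+ j ⟧ ≈ ⟦ i ⟧ + ⟦ j ⟧
  +-homo -[1+ m ] -[1+ n ] = begin
    - (suc (suc (m ℕ.+ n)) · 1#)        ≡⟨ ≡.cong (λ k → - (suc k · 1#)) (≡.sym (ℕ.+-suc m n)) ⟩
    - ((suc m ℕ.+ suc n) · 1#)          ≈⟨ -‿cong (×-homo-+ 1# (suc m) (suc n)) ⟩
    - (suc m · 1# + suc n · 1#)         ≈⟨ ⁻¹-∙-comm _ _ ⟨
    - (suc m · 1#) - suc n · 1#         ∎
  +-homo -[1+ m ] (+ n)    = trans (⊖-homo n (suc m)) (+-comm _ _)
  +-homo (+ m)    -[1+ n ] = ⊖-homo m (suc n)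
  +-homo (+ m)    (+ n)    = ×-homo-+ 1# m n

  ℤ-morphism : ℤ.+-*-rawRing -Raw-AlmostCommutative⟶ fromCommutativeRing R
  ℤ-morphism = record
    { ⟦_⟧ = ⟦_⟧ ; +-homo = +-homo ; *-homo = *-homo ; -‿homo = -‿homo
    ; 0-homo = refl ; 1-homo = +-identityʳ 1# }

  -- equal integers have equal images; the solver only needs this test
  ℤ-equal? : ∀ i j → Maybe (⟦ i ⟧ ≈ ⟦ j ⟧)
  ℤ-equal? i j with i ℤ.≟ j
  ... | yes ≡.refl = just refl
  ... | no _       = nothing

  open RingSolver ℤ.+-*-rawRing (fromCommutativeRing R) ℤ-morphism ℤ-equal? public
    using (solve; _:=_; _:+_; _:*_; _:-_; :-_; con)

module RangeSum {c ℓ} (K : CommutativeRing c ℓ) where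
  open CommutativeRing K
  open import Relation.Binary.Reasoning.Setoid setoid
  open import Algebra.Properties.Ring ring using (-0#≈0#; -‿anti-homo-+)
  open import Algebra.Properties.CommutativeSemigroup +-commutativeSemigroup using (interchange)
  open CommutativeMonoidSum +-commutativeMonoid using (sum)

  ∑< : ℕ → (ℕ → Carrier) → Carrier
  ∑< zero    f = 0#
  ∑< (suc N) f = f N + ∑< N f

  ∑<-cong : ∀ N {f g} → (∀ k → f k ≈ g k) → ∑< N f ≈ ∑< N g
  ∑<-cong zero    f≈g = refl
  ∑<-cong (suc N) f≈g = +-cong (f≈g N) (∑<-cong N f≈g)

  ∑<-+ : ∀ N f g → ∑< N (λ k → f k + g k) ≈ ∑< N f + ∑< N g
  ∑<-+ zero    f g = sym (+-identityˡ 0#)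
  ∑<-+ (suc N) f g = trans (+-congˡ (∑<-+ N f g)) (interchange _ _ _ _)

  ∑<-neg : ∀ N f → ∑< N (λ k → - f k) ≈ - ∑< N f
  ∑<-neg zero    f = sym -0#≈0#
  ∑<-neg (suc N) f = trans (+-congˡ (∑<-neg N f)) (trans (+-comm _ _) (sym (-‿anti-homo-+ _ _)))

  ∑<-distribˡ : ∀ N x f → x * ∑< N f ≈ ∑< N (λ k → x * f k)
  ∑<-distribˡ zero    x f = zeroʳ x
  ∑<-distribˡ (suc N) x f = trans (distribˡ _ _ _) (+-congˡ (∑<-distribˡ N x f))

  ∑<-zero : ∀ N f → (∀ k → k < N → f k ≈ 0#) → ∑< N f ≈ 0#
  ∑<-zero zero    f f≈0 = refl
  ∑<-zero (suc N) f f≈0 = trans (+-cong (f≈0 N (ℕ.n<1+n N)) (∑<-zero N f (λ k k<N → f≈0 k (ℕ.m<n⇒m<1+n k<N))))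
                                (+-identityʳ 0#)

  ∑<-single : ∀ N a {X} f → a < N → f a ≈ X → (∀ k → k ≢ a → f k ≈ 0#) → ∑< N f ≈ X
  ∑<-single (suc N) a {X} f a<1+N fa≈X f≈0 with N ℕ.≟ a
  ... | yes ≡.refl = trans (+-cong fa≈X (∑<-zero N f (λ k k<N → f≈0 k (λ { ≡.refl → ℕ.<-irrefl ≡.refl k<N }))))
                           (+-identityʳ X)
  ... | no N≢a = trans (+-cong (f≈0 N N≢a) (∑<-single N a f a<N fa≈X f≈0)) (+-identityˡ X)
    where
    a<N : a < N
    a<N = ℕ.≤∧≢⇒< (ℕ.≤-pred a<1+N) (N≢a ∘ ≡.sym)

  sum-∑< : ∀ {M} N (f : Fin M → ℕ → Carrier) → sum (λ i → ∑< N (f i)) ≈ ∑< N (λ k → sum (λ i → f i k))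
  sum-∑< {zero}  N f = sym (∑<-zero N _ (λ _ _ → refl))
  sum-∑< {suc M} N f = trans (+-congˡ (sum-∑< N (f ∘ suc))) (sym (∑<-+ N _ _))

module DoubleSums {c ℓ} (K : CommutativeRing c ℓ) where
  open CommutativeRing K hiding (zero)
  open import Relation.Binary.Reasoning.Setoid setoid
  open import Algebra.Properties.Ring ring using (-1*x≈-x)
  open import Algebra.Properties.AbelianGroup +-abelianGroup using (xyx⁻¹≈y)
  open import Algebra.Properties.Semiring.Sum semiring using (*-distribˡ-sum; *-distribʳ-sum)
  open CommutativeMonoidSum +-commutativeMonoid using (sum; sum-cong-≋; sum-remove; ∑-distrib-+; ∑-comm)

  sum-neg : ∀ {n} (x : Fin n → Carrier) → - sum x ≈ sum (λ i → - x i)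
  sum-neg x = begin
    - sum x                     ≈⟨ -1*x≈-x (sum x) ⟨
    - 1# * sum x                ≈⟨ *-distribˡ-sum (- 1#) x ⟩
    sum (λ i → - 1# * x i)      ≈⟨ sum-cong-≋ (λ i → -1*x≈-x (x i)) ⟩
    sum (λ i → - x i)           ∎

  sum-*-sum : ∀ {m n} (x : Fin m → Carrier) (y : Fin n → Carrier) →
              sum x * sum y ≈ sum (λ i → sum (λ j → x i * y j))
  sum-*-sum x y = trans (*-distribʳ-sum (sum y) x) (sum-cong-≋ (λ i → *-distribˡ-sum (x i) y))

  off-diagonal : ∀ {n} (h G : Fin n → Fin n → Carrier) → (∀ i j → i ≢ j → h i j ≈ G i j) → (∀ i → G i i ≈ 0#) →
                 sum (λ i → sum (h i)) - sum (λ i → h i i) ≈ sum (λ i → sum (G i))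
  off-diagonal {zero}  h G h≈G G-diagonal = -‿inverseʳ 0#
  off-diagonal {suc n} h G h≈G G-diagonal = begin
    sum (λ i → sum (h i)) - sum (λ i → h i i)      ≈⟨ +-congˡ (sum-neg (λ i → h i i)) ⟩
    sum (λ i → sum (h i)) + sum (λ i → - h i i)    ≈⟨ ∑-distrib-+ (λ i → sum (h i)) (λ i → - h i i) ⟨
    sum (λ i → sum (h i) - h i i)                  ≈⟨ sum-cong-≋ row ⟩
    sum (λ i → sum (G i))                          ∎
    where
    row : ∀ i → sum (h i) - h i i ≈ sum (G i)
    row i = begin
      sum (h i) - h i i                                 ≈⟨ +-congʳ (sum-remove {i = i} (h i)) ⟩
      (h i i + sum (h i ∘ punchIn i)) - h i i           ≈⟨ xyx⁻¹≈y (h i i) _ ⟩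
      sum (h i ∘ punchIn i)                             ≈⟨ sum-cong-≋ (λ j → h≈G i (punchIn i j) (punchInᵢ≢i i j ∘ ≡.sym)) ⟩
      sum (G i ∘ punchIn i)                             ≈⟨ +-identityˡ _ ⟨
      0# + sum (G i ∘ punchIn i)                        ≈⟨ +-congʳ (G-diagonal i) ⟨
      G i i + sum (G i ∘ punchIn i)                     ≈⟨ sum-remove {i = i} (G i) ⟨
      sum (G i)                                         ∎

  balanced-sum : ∀ {n} (D : Fin n → Fin n → Carrier) P α β (w : Fin n → Carrier) →
                 (∀ i → sum (D i) ≈ P) → (∀ j → sum (λ i → D i j) ≈ P) →
                 sum (λ i → sum (λ j → D i j * (α * w i + β * w j))) ≈ (α + β) * (sum w * P)
  balanced-sum D P α β w rows columns = begin
    sum (λ i → sum (λ j → D i j * (α * w i + β * w j)))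
      ≈⟨ sum-cong-≋ (λ i → trans (sum-cong-≋ (split i)) (∑-distrib-+ (λ j → α * (w i * D i j)) (λ j → β * (w j * D i j)))) ⟩
    sum (λ i → sum (λ j → α * (w i * D i j)) + sum (λ j → β * (w j * D i j)))
      ≈⟨ ∑-distrib-+ (λ i → sum (λ j → α * (w i * D i j))) (λ i → sum (λ j → β * (w j * D i j))) ⟩
    sum (λ i → sum (λ j → α * (w i * D i j))) + sum (λ i → sum (λ j → β * (w j * D i j)))
      ≈⟨ +-congˡ (∑-comm (λ i j → β * (w j * D i j))) ⟩
    sum (λ i → sum (λ j → α * (w i * D i j))) + sum (λ j → sum (λ i → β * (w j * D i j)))
      ≈⟨ +-cong (weighted α D rows) (weighted β (λ j i → D i j) columns) ⟩
    α * (sum w * P) + β * (sum w * P)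
      ≈⟨ distribʳ _ _ _ ⟨
    (α + β) * (sum w * P)
      ∎
    where
    split : ∀ i j → D i j * (α * w i + β * w j) ≈ α * (w i * D i j) + β * (w j * D i j)
    split i j = trans (*-comm _ _) (trans (distribʳ _ _ _) (+-cong (*-assoc _ _ _) (*-assoc _ _ _)))
    weighted : ∀ γ (E : Fin _ → Fin _ → Carrier) → (∀ i → sum (E i) ≈ P) →
               sum (λ i → sum (λ j → γ * (w i * E i j))) ≈ γ * (sum w * P)
    weighted γ E E-rows = begin
      sum (λ i → sum (λ j → γ * (w i * E i j)))   ≈⟨ sum-cong-≋ (λ i → *-distribˡ-sum γ (λ j → w i * E i j)) ⟨
      sum (λ i → γ * sum (λ j → w i * E i j))     ≈⟨ sum-cong-≋ (λ i → *-congˡ (*-distribˡ-sum (w i) (E i))) ⟨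
      sum (λ i → γ * (w i * sum (E i)))           ≈⟨ sum-cong-≋ (λ i → *-congˡ (*-congˡ (E-rows i))) ⟩
      sum (λ i → γ * (w i * P))                   ≈⟨ *-distribˡ-sum γ (λ i → w i * P) ⟨
      γ * sum (λ i → w i * P)                     ≈⟨ *-congˡ (*-distribʳ-sum P w) ⟨
      γ * (sum w * P)                             ∎

module Characteristic {c ℓ} (K : CommutativeRing c ℓ) (p : ℕ) {{_ : NonZero p}} where
  open CommutativeRing K hiding (zero)
  open import Relation.Binary.Reasoning.Setoid setoid
  open import Algebra.Definitions.RawMonoid +-rawMonoid using () renaming (_×_ to _·_)
  open import Algebra.Properties.Monoid.Mult +-monoid using (×-homo-+; ×-assocˡ; ×-congʳ)
  open import Algebra.Properties.Semiring.Mult semiring using (×-assoc-*)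
  open import Algebra.Properties.Group +-group using (inverseˡ-unique)

  module _ (p·1≈0 : p · 1# ≈ 0#) where

    p·≈0 : ∀ x → p · x ≈ 0#
    p·≈0 x = begin
      p · x            ≈⟨ ×-congʳ p (*-identityˡ x) ⟨
      p · (1# * x)     ≈⟨ ×-assoc-* p 1# x ⟨
      (p · 1#) * x     ≈⟨ *-congʳ p·1≈0 ⟩
      0# * x           ≈⟨ zeroˡ x ⟩
      0#               ∎

    [p-1]·≈- : ∀ x → (p ∸ 1) · x ≈ - x
    [p-1]·≈- x = inverseˡ-unique ((p ∸ 1) · x) x (begin
      (p ∸ 1) · x + x     ≈⟨ +-comm _ _ ⟩
      suc (p ∸ 1) · x     ≡⟨ ≡.cong (_· x) (ℕ.m+[n∸m]≡n (ℕ.>-nonZero⁻¹ p)) ⟩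
      p · x               ≈⟨ p·≈0 x ⟩
      0#                  ∎)

    ·-mod : ∀ n x → (n % p) · x ≈ n · x
    ·-mod n x = sym (begin
      n · x                                   ≡⟨ ≡.cong (_· x) (m≡m%n+[m/n]*n n p) ⟩
      (n % p ℕ.+ (n / p) ℕ.* p) · x           ≈⟨ ×-homo-+ x (n % p) _ ⟩
      (n % p) · x + ((n / p) ℕ.* p) · x       ≈⟨ +-congˡ (×-assocˡ x (n / p) p) ⟨
      (n % p) · x + (n / p) · (p · x)         ≈⟨ +-congˡ (×-congʳ (n / p) (p·≈0 x)) ⟩
      (n % p) · x + (n / p) · 0#              ≈⟨ +-congˡ (·-zeroʳ (n / p)) ⟩
      (n % p) · x + 0#                        ≈⟨ +-identityʳ _ ⟩
      (n % p) · x                             ∎)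
      where
      ·-zeroʳ : ∀ n → n · 0# ≈ 0#
      ·-zeroʳ zero    = refl
      ·-zeroʳ (suc n) = trans (+-identityˡ _) (·-zeroʳ n)

-- Partial fractions in characteristic p.  If u - v = c u v, then for a + b ≥ 1
--   c^(a+b) u^a v^b = Σ_{k<a+b} c^(k+1) (A_k u^(k+1) + B_k v^(k+1))
-- with natural coefficients A_k = coeffᵤ a b k and B_k = coeffᵥ a b k given by a
-- Pascal-type recursion in which p - 1 plays the role of -1.
module PartialFractions {c ℓ} (K : CommutativeRing c ℓ) (p : ℕ) {{_ : NonZero p}} where
  open CommutativeRing K hiding (zero)
  open import Relation.Binary.Reasoning.Setoid setoid
  open import Algebra.Definitions.RawMonoid +-rawMonoid using () renaming (_×_ to _·_)
  open import Algebra.Properties.Monoid.Mult +-monoid using (×-homo-+; ×-assocˡ)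
  open import Algebra.Properties.Semiring.Exp semiring using (_^_)
  open IntegerSolver K using (solve; _:=_; _:+_; _:*_; _:-_)
  open RangeSum K
  open Characteristic K p

  δ : ℕ → ℕ → ℕ
  δ k j with k ℕ.≟ j
  ... | yes _ = 1
  ... | no  _ = 0

  δ-refl : ∀ k → δ k k ≡ 1
  δ-refl k with k ℕ.≟ k
  ... | yes _ = ≡.refl
  ... | no k≢k = contradiction ≡.refl k≢k

  δ-≢ : ∀ k j → k ≢ j → δ k j ≡ 0
  δ-≢ k j k≢j with k ℕ.≟ j
  ... | yes k≡j = contradiction k≡j k≢j
  ... | no  _   = ≡.refl

  coeffᵤ : ℕ → ℕ → ℕ → ℕ
  coeffᵤ zero    b       k = 0
  coeffᵤ (suc a) zero    k = δ k a
  coeffᵤ (suc a) (suc b) k = coeffᵤ (suc a) b k ℕ.+ (p ∸ 1) ℕ.* coeffᵤ a (suc b) k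

  coeffᵥ : ℕ → ℕ → ℕ → ℕ
  coeffᵥ a       zero    k = 0
  coeffᵥ zero    (suc b) k = δ k b
  coeffᵥ (suc a) (suc b) k = coeffᵥ (suc a) b k ℕ.+ (p ∸ 1) ℕ.* coeffᵥ a (suc b) k

  term : Carrier → Carrier → Carrier → ℕ → ℕ → ℕ → Carrier
  term c u v a b k = c ^ suc k * (coeffᵤ a b k · u ^ suc k + coeffᵥ a b k · v ^ suc k)

  module _ (p·1≈0 : p · 1# ≈ 0#) (c u v : Carrier) (u-v≈cuv : u - v ≈ c * (u * v)) where

    T : ℕ → ℕ → ℕ → Carrier
    T = term c u v

    ·-step : ∀ x y w → (x ℕ.+ (p ∸ 1) ℕ.* y) · w ≈ x · w - y · w
    ·-step x y w = trans (×-homo-+ w x _) (+-congˡ (trans (sym (×-assocˡ w (p ∸ 1) y)) ([p-1]·≈- p·1≈0 (y · w))))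

    term-step : ∀ a b k → T (suc a) (suc b) k ≈ T (suc a) b k - T a (suc b) k
    term-step a b k = begin
      C * (coeffᵤ (suc a) (suc b) k · U + coeffᵥ (suc a) (suc b) k · V)
        ≈⟨ *-congˡ (+-cong (·-step A₁ A₂ U) (·-step B₁ B₂ V)) ⟩
      C * ((A₁ · U - A₂ · U) + (B₁ · V - B₂ · V))
        ≈⟨ solve 5 (λ C a₁ a₂ b₁ b₂ → C :* ((a₁ :- a₂) :+ (b₁ :- b₂)) := C :* (a₁ :+ b₁) :- C :* (a₂ :+ b₂))
                   refl C (A₁ · U) (A₂ · U) (B₁ · V) (B₂ · V) ⟩
      C * (A₁ · U + B₁ · V) - C * (A₂ · U + B₂ · V)
        ∎
      where
      C U V : Carrier
      C = c ^ suc k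
      U = u ^ suc k
      V = v ^ suc k
      A₁ A₂ B₁ B₂ : ℕ
      A₁ = coeffᵤ (suc a) b k
      A₂ = coeffᵤ a (suc b) k
      B₁ = coeffᵥ (suc a) b k
      B₂ = coeffᵥ a (suc b) k

    monomial-step : ∀ a b → c ^ (suc a ℕ.+ suc b) * (u ^ suc a * v ^ suc b)
                          ≈ c ^ (suc a ℕ.+ b) * (u ^ suc a * v ^ b) - c ^ (a ℕ.+ suc b) * (u ^ a * v ^ suc b)
    monomial-step a b = begin
      c ^ (suc a ℕ.+ suc b) * (u ^ suc a * v ^ suc b)     ≡⟨ ≡.cong (λ e → c ^ e * (u ^ suc a * v ^ suc b)) (ℕ.+-suc (suc a) b) ⟩
      (c * n) * ((u * X) * (v * Y))                        ≈⟨ solve 6 (λ c n u v X Y → (c :* n) :* ((u :* X) :* (v :* Y)) := n :* ((c :* (u :* v)) :* (X :* Y))) refl c n u v X Y ⟩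
      n * ((c * (u * v)) * (X * Y))                        ≈⟨ *-congˡ (*-congʳ u-v≈cuv) ⟨
      n * ((u - v) * (X * Y))                              ≈⟨ solve 5 (λ n u v X Y → n :* ((u :- v) :* (X :* Y)) := n :* ((u :* X) :* Y) :- n :* (X :* (v :* Y))) refl n u v X Y ⟩
      n * (u ^ suc a * Y) - n * (X * v ^ suc b)            ≡⟨ ≡.cong (λ e → n * (u ^ suc a * Y) - c ^ e * (X * v ^ suc b)) (≡.sym (ℕ.+-suc a b)) ⟩
      n * (u ^ suc a * Y) - c ^ (a ℕ.+ suc b) * (X * v ^ suc b) ∎
      where
      n X Y : Carrier
      n = c ^ (suc a ℕ.+ b)
      X = u ^ a
      Y = v ^ b

    partialFractions : ∀ N a b → 1 ≤ a ℕ.+ b → a ℕ.+ b ≤ N → c ^ (a ℕ.+ b) * (u ^ a * v ^ b) ≈ ∑< N (term c u v a b)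
    partialFractions N zero    zero    ()    _
    partialFractions N (suc a) zero 1≤a+b a+b≤N =
      sym (∑<-single N a (T (suc a) zero) (≡.subst (_≤ N) (ℕ.+-identityʳ (suc a)) a+b≤N) term-a off-a)
      where
      term-a : T (suc a) zero a ≈ c ^ (suc a ℕ.+ zero) * (u ^ suc a * 1#)
      term-a = begin
        c ^ suc a * (δ a a · u ^ suc a + 0#)   ≡⟨ ≡.cong (λ n → c ^ suc a * (n · u ^ suc a + 0#)) (δ-refl a) ⟩
        c ^ suc a * ((u ^ suc a + 0#) + 0#)   ≈⟨ *-congˡ (trans (+-identityʳ _) (+-identityʳ _)) ⟩
        c ^ suc a * u ^ suc a                 ≈⟨ *-cong (reflexive (≡.cong (c ^_) (ℕ.+-identityʳ (suc a)))) (*-identityʳ _) ⟨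
        c ^ (suc a ℕ.+ zero) * (u ^ suc a * 1#) ∎
      off-a : ∀ k → k ≢ a → T (suc a) zero k ≈ 0#
      off-a k k≢a = begin
        c ^ suc k * (δ k a · u ^ suc k + 0#)  ≡⟨ ≡.cong (λ n → c ^ suc k * (n · u ^ suc k + 0#)) (δ-≢ k a k≢a) ⟩
        c ^ suc k * (0# + 0#)                 ≈⟨ *-congˡ (+-identityʳ 0#) ⟩
        c ^ suc k * 0#                        ≈⟨ zeroʳ _ ⟩
        0#                                    ∎
    partialFractions N zero (suc b) 1≤a+b a+b≤N =
      sym (∑<-single N b (T zero (suc b)) a+b≤N term-b off-b)
      where
      term-b : T zero (suc b) b ≈ c ^ suc b * (1# * v ^ suc b)
      term-b = begin
        c ^ suc b * (0# + δ b b · v ^ suc b)   ≡⟨ ≡.cong (λ n → c ^ suc b * (0# + n · v ^ suc b)) (δ-refl b) ⟩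
        c ^ suc b * (0# + (v ^ suc b + 0#))   ≈⟨ *-congˡ (trans (+-identityˡ _) (+-identityʳ _)) ⟩
        c ^ suc b * v ^ suc b                 ≈⟨ *-congˡ (*-identityˡ _) ⟨
        c ^ suc b * (1# * v ^ suc b)          ∎
      off-b : ∀ k → k ≢ b → T zero (suc b) k ≈ 0#
      off-b k k≢b = begin
        c ^ suc k * (0# + δ k b · v ^ suc k)  ≡⟨ ≡.cong (λ n → c ^ suc k * (0# + n · v ^ suc k)) (δ-≢ k b k≢b) ⟩
        c ^ suc k * (0# + 0#)                 ≈⟨ *-congˡ (+-identityʳ 0#) ⟩
        c ^ suc k * 0#                        ≈⟨ zeroʳ _ ⟩
        0#                                    ∎
    partialFractions N (suc a) (suc b) _ a+b≤N = begin
      c ^ (suc a ℕ.+ suc b) * (u ^ suc a * v ^ suc b)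
        ≈⟨ monomial-step a b ⟩
      c ^ (suc a ℕ.+ b) * (u ^ suc a * v ^ b) - c ^ (a ℕ.+ suc b) * (u ^ a * v ^ suc b)
        ≈⟨ +-cong (partialFractions N (suc a) b (s≤s z≤n) a+1+b≤N)
                  (-‿cong (partialFractions N a (suc b) (≡.subst (1 ≤_) (≡.sym (ℕ.+-suc a b)) (s≤s z≤n))
                                            (≡.subst (_≤ N) (≡.sym (ℕ.+-suc a b)) a+1+b≤N))) ⟩
      ∑< N (T (suc a) b) - ∑< N (T a (suc b))
        ≈⟨ +-congˡ (∑<-neg N _) ⟨
      ∑< N (T (suc a) b) + ∑< N (λ k → - T a (suc b) k)
        ≈⟨ ∑<-+ N _ _ ⟨
      ∑< N (λ k → T (suc a) b k - T a (suc b) k)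
        ≈⟨ ∑<-cong N (λ k → sym (term-step a b k)) ⟩
      ∑< N (T (suc a) (suc b))
        ∎
      where
      a+1+b≤N : suc a ℕ.+ b ≤ N
      a+1+b≤N = ℕ.≤-trans (ℕ.n≤1+n _) (≡.subst (_≤ N) (ℕ.+-suc (suc a) b) a+b≤N)

module FiniteField {c ℓ} (R : CommutativeRing c ℓ) (q' : ℕ) {{_ : NonZero q'}}
                   (F : IsFiniteField R (suc q')) where
  open CommutativeRing R hiding (zero)
  open IsFiniteField F
  open import Relation.Binary.Reasoning.Setoid setoid
  open import Algebra.Properties.Semiring.Exp semiring using (_^_; ^-congˡ; ^-homo-*; ^-assocʳ)
  open import Algebra.Properties.CommutativeSemiring.Exp commutativeSemiring using (^-distrib-*)
  open import Algebra.Properties.Semiring.Sum semiring using (*-distribˡ-sum)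
  open import Algebra.Properties.Ring ring using (-‿involutive; -0#≈0#; x[y-z]≈xy-xz; [y-z]x≈yx-zx)
  open import Algebra.Properties.Group +-group using (inverseʳ-unique; x∙y⁻¹≈ε⇒x≈y)
  open import Algebra.Definitions.RawMonoid +-rawMonoid using () renaming (_×_ to _·_)
  open IntegerSolver R using (solve; _:=_; _:+_; _:*_; _:-_)
  open CommutativeMonoidSum +-commutativeMonoid using (sum; sum-cong-≋; sum-remove; sum-replicate)
  module Product = CommutativeMonoidSum *-commutativeMonoid

  q : ℕ
  q = suc q'

  index : Carrier → Fin q
  index x = proj₁ (enum-surj x)

  enum-index : ∀ x → enum (index x) ≈ x
  enum-index x = proj₂ (enum-surj x)

  index-cong : ∀ {x y} → x ≈ y → index x ≡ index y
  index-cong {x} {y} x≈y = enum-inj _ _ (trans (enum-index x) (trans x≈y (sym (enum-index y))))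

  index-enum : ∀ i → index (enum i) ≡ i
  index-enum i = enum-inj _ _ (enum-index (enum i))

  infix 4 _≟_
  _≟_ : ∀ x y → Dec (x ≈ y)
  x ≟ y with index x ≟ᶠ index y
  ... | yes e = yes (trans (sym (enum-index x)) (trans (reflexive (≡.cong enum e)) (enum-index y)))
  ... | no ne = no (ne ∘ index-cong)

  cancel-zero : ∀ {x y} → ¬ x ≈ 0# → x * y ≈ 0# → y ≈ 0#
  cancel-zero {x} {y} x≉0 xy≈0 = begin
    y               ≈⟨ *-identityˡ y ⟨
    1# * y          ≈⟨ *-congʳ (trans (*-comm _ _) x⁻¹-inverse) ⟨
    (x⁻¹ * x) * y   ≈⟨ *-assoc _ _ _ ⟩
    x⁻¹ * (x * y)   ≈⟨ *-congˡ xy≈0 ⟩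
    x⁻¹ * 0#        ≈⟨ zeroʳ _ ⟩
    0#              ∎
    where
    x⁻¹ : Carrier
    x⁻¹ = proj₁ (inverse x x≉0)
    x⁻¹-inverse : x * x⁻¹ ≈ 1#
    x⁻¹-inverse = proj₂ (inverse x x≉0)

  *-nonzero : ∀ {x y} → ¬ x ≈ 0# → ¬ y ≈ 0# → ¬ (x * y) ≈ 0#
  *-nonzero x≉0 y≉0 xy≈0 = y≉0 (cancel-zero x≉0 xy≈0)

  difference-zero : ∀ {x y} → x - y ≈ 0# → x ≈ y
  difference-zero {x} {y} = x∙y⁻¹≈ε⇒x≈y x y

  *-cancelˡ : ∀ {x y z} → ¬ x ≈ 0# → x * y ≈ x * z → y ≈ z
  *-cancelˡ {x} {y} {z} x≉0 xy≈xz = difference-zero (cancel-zero x≉0 (begin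
    x * (y - z)      ≈⟨ x[y-z]≈xy-xz x y z ⟩
    x * y - x * z    ≈⟨ +-congʳ xy≈xz ⟩
    x * z - x * z    ≈⟨ -‿inverseʳ _ ⟩
    0#               ∎))

  -1≉0 : ¬ (- 1#) ≈ 0#
  -1≉0 -1≈0 = one≉zero (trans (sym (-‿involutive 1#)) (trans (-‿cong -1≈0) -0#≈0#))

  record FieldPermutation : Set (c ⊔ ℓ) where
    field
      to from   : Carrier → Carrier
      to-cong   : ∀ {x y} → x ≈ y → to x ≈ to y
      from-cong : ∀ {x y} → x ≈ y → from x ≈ from y
      from-to   : ∀ x → from (to x) ≈ x
      to-from   : ∀ x → to (from x) ≈ x

    indexPermutation : Permutation q q
    indexPermutation = permutation (λ i → index (to (enum i))) (λ j → index (from (enum j)))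
      (λ j → ≡.trans (index-cong (trans (to-cong (enum-index _)) (to-from _))) (index-enum j))
      (λ i → ≡.trans (index-cong (trans (from-cong (enum-index _)) (from-to _))) (index-enum i))

  module Reindex {c′ ℓ′} (M : CommutativeMonoid c′ ℓ′) where
    private module M = CommutativeMonoid M
    open CommutativeMonoidSum M using () renaming (sum to ∑; sum-permute to ∑-permute; sum-cong-≋ to ∑-cong)

    reindex : (h : Carrier → M.Carrier) → (∀ {x y} → x ≈ y → h x M.≈ h y) → (σ : FieldPermutation)
      → ∑ (h ∘ enum) M.≈ ∑ (h ∘ FieldPermutation.to σ ∘ enum)
    reindex h h-cong σ = M.trans (∑-permute (h ∘ enum) indexPermutation)
                                 (∑-cong {_} {λ i → h (enum (index (to (enum i))))} (λ i → h-cong (enum-index _)))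
      where open FieldPermutation σ

  scaling : ∀ d → ¬ d ≈ 0# → FieldPermutation
  scaling d d≉0 = record
    { to = d *_ ; from = d⁻¹ *_ ; to-cong = *-congˡ ; from-cong = *-congˡ
    ; from-to = λ x → trans (sym (*-assoc _ _ _)) (trans (*-congʳ (trans (*-comm _ _) d⁻¹-inverse)) (*-identityˡ x))
    ; to-from = λ x → trans (sym (*-assoc _ _ _)) (trans (*-congʳ d⁻¹-inverse) (*-identityˡ x)) }
    where
    d⁻¹ : Carrier
    d⁻¹ = proj₁ (inverse d d≉0)
    d⁻¹-inverse : d * d⁻¹ ≈ 1#
    d⁻¹-inverse = proj₂ (inverse d d≉0)

  translation : Carrier → FieldPermutation
  translation y = record
    { to = _- y ; from = _+ y ; to-cong = +-congʳ ; from-cong = +-congʳ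
    ; from-to = λ x → solve 2 (λ x y → (x :- y) :+ y := x) refl x y
    ; to-from = λ x → solve 2 (λ x y → (x :+ y) :- y := x) refl x y }

  reflection : Carrier → FieldPermutation
  reflection y = record
    { to = λ x → y - x ; from = λ x → y - x ; to-cong = +-congˡ ∘ -‿cong ; from-cong = +-congˡ ∘ -‿cong
    ; from-to = λ x → solve 2 (λ x y → y :- (y :- x) := x) refl x y
    ; to-from = λ x → solve 2 (λ x y → y :- (y :- x) := x) refl x y }

  module ReindexSum = Reindex +-commutativeMonoid
  module ReindexProduct = Reindex *-commutativeMonoid

  zeroIndex : Fin q
  zeroIndex = index 0#

  nonzero : Fin q' → Carrier
  nonzero j = enum (punchIn zeroIndex j)

  nonzero-≉0 : ∀ j → ¬ nonzero j ≈ 0#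
  nonzero-≉0 j e = punchInᵢ≢i zeroIndex j (enum-inj _ _ (trans e (sym (enum-index 0#))))

  nonzero-injective : ∀ j k → nonzero j ≈ nonzero k → j ≡ k
  nonzero-injective j k e = punchIn-injective zeroIndex j k (enum-inj _ _ e)

  -- x* is x with 0 replaced by 1, and d_x is d for x ≠ 0 and 1 for x = 0, so that (d x)* = d_x x*
  nonzeroPart : Carrier → Carrier
  nonzeroPart x with x ≟ 0#
  ... | yes _ = 1#
  ... | no  _ = x

  scaleFactor : Carrier → Carrier → Carrier
  scaleFactor d x with x ≟ 0#
  ... | yes _ = 1#
  ... | no  _ = d

  nonzeroPart-cong : ∀ {x y} → x ≈ y → nonzeroPart x ≈ nonzeroPart y
  nonzeroPart-cong {x} {y} x≈y with x ≟ 0# | y ≟ 0#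
  ... | yes _   | yes _   = refl
  ... | yes x≈0 | no y≉0  = contradiction (trans (sym x≈y) x≈0) y≉0
  ... | no x≉0  | yes y≈0 = contradiction (trans x≈y y≈0) x≉0
  ... | no _    | no _    = x≈y

  nonzeroPart-≉0 : ∀ x → ¬ nonzeroPart x ≈ 0#
  nonzeroPart-≉0 x with x ≟ 0#
  ... | yes _   = one≉zero
  ... | no  x≉0 = x≉0

  nonzeroPart-scale : ∀ d → ¬ d ≈ 0# → ∀ x → nonzeroPart (d * x) ≈ scaleFactor d x * nonzeroPart x
  nonzeroPart-scale d d≉0 x with x ≟ 0# | (d * x) ≟ 0#
  ... | yes _   | yes _    = sym (*-identityˡ _)
  ... | yes x≈0 | no dx≉0  = contradiction (trans (*-congˡ x≈0) (zeroʳ d)) dx≉0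
  ... | no x≉0  | yes dx≈0 = contradiction dx≈0 (*-nonzero d≉0 x≉0)
  ... | no _    | no _     = refl

  scaleFactor-≈0 : ∀ d x → x ≈ 0# → scaleFactor d x ≈ 1#
  scaleFactor-≈0 d x x≈0 with x ≟ 0#
  ... | yes _   = refl
  ... | no x≉0 = contradiction x≈0 x≉0

  scaleFactor-≉0 : ∀ d x → ¬ x ≈ 0# → scaleFactor d x ≈ d
  scaleFactor-≉0 d x x≉0 with x ≟ 0#
  ... | yes x≈0 = contradiction x≈0 x≉0
  ... | no _    = refl

  product-≉0 : ∀ {n} (g : Fin n → Carrier) → (∀ i → ¬ g i ≈ 0#) → ¬ Product.sum g ≈ 0#
  product-≉0 {zero}  g g≉0 = one≉zero
  product-≉0 {suc n} g g≉0 = *-nonzero (g≉0 zero) (product-≉0 (g ∘ suc) (g≉0 ∘ suc))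

  -- Fermat's little theorem: reindexing by x ↦ d x gives Π_x x* = (Π_x d_x) (Π_x x*),
  -- the product Π_x x* is nonzero, and Π_x d_x = d^(q-1)
  fermat : ∀ d → ¬ d ≈ 0# → d ^ q' ≈ 1#
  fermat d d≉0 = trans (sym Πfactor≈d^q') Πfactor≈1
    where
    Πpart Πfactor : Carrier
    Πpart = Product.sum (nonzeroPart ∘ enum)
    Πfactor = Product.sum (scaleFactor d ∘ enum)
    Πpart≈ΠfactorΠpart : Πpart ≈ Πfactor * Πpart
    Πpart≈ΠfactorΠpart = begin
      Πpart                                               ≈⟨ ReindexProduct.reindex nonzeroPart nonzeroPart-cong (scaling d d≉0) ⟩
      Product.sum (λ i → nonzeroPart (d * enum i))        ≈⟨ Product.sum-cong-≋ (nonzeroPart-scale d d≉0 ∘ enum) ⟩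
      Product.sum (λ i → scaleFactor d (enum i) * nonzeroPart (enum i)) ≈⟨ Product.∑-distrib-+ (scaleFactor d ∘ enum) (nonzeroPart ∘ enum) ⟩
      Πfactor * Πpart                                     ∎
    Πfactor≈1 : Πfactor ≈ 1#
    Πfactor≈1 = *-cancelˡ (product-≉0 (nonzeroPart ∘ enum) (nonzeroPart-≉0 ∘ enum))
      (trans (*-comm _ _) (trans (sym Πpart≈ΠfactorΠpart) (sym (*-identityʳ Πpart))))
    Πfactor≈d^q' : Πfactor ≈ d ^ q'
    Πfactor≈d^q' = begin
      Πfactor                                        ≈⟨ Product.sum-remove {i = zeroIndex} (scaleFactor d ∘ enum) ⟩
      scaleFactor d (enum zeroIndex) * Product.sum (scaleFactor d ∘ nonzero)
        ≈⟨ *-cong (scaleFactor-≈0 d _ (enum-index 0#))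
                  (Product.sum-cong-≋ (λ j → scaleFactor-≉0 d _ (nonzero-≉0 j))) ⟩
      1# * Product.sum {q'} (λ _ → d)                ≈⟨ *-identityˡ _ ⟩
      Product.sum {q'} (λ _ → d)                     ≈⟨ Product.sum-replicate q' ⟩
      d ^ q'                                         ∎

  fermat-multiple : ∀ x → ¬ x ≈ 0# → ∀ k → x ^ (q' ℕ.* k) ≈ 1#
  fermat-multiple x x≉0 k = begin
    x ^ (q' ℕ.* k)     ≈⟨ ^-assocʳ x q' k ⟨
    (x ^ q') ^ k       ≈⟨ ^-congˡ k (fermat x x≉0) ⟩
    1# ^ k             ≈⟨ 1^k k ⟩
    1#                 ∎
    where
    1^k : ∀ k → 1# ^ k ≈ 1#
    1^k zero    = refl
    1^k (suc k) = trans (*-identityˡ _) (1^k k)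

  -- PolyFun L f: f is a polynomial function x ↦ a₀ + x (a₁ + x (…)) with at most L coefficients
  data PolyFun : ℕ → (Carrier → Carrier) → Set (c ⊔ ℓ) where
    vanishing : ∀ {f} → (∀ x → f x ≈ 0#) → PolyFun zero f
    horner    : ∀ {L f} a g → PolyFun L g → (∀ x → f x ≈ a + x * g x) → PolyFun (suc L) f

  PolyFun-suc : ∀ {L f} → PolyFun L f → PolyFun (suc L) f
  PolyFun-suc (vanishing f≈0) =
    horner 0# (λ _ → 0#) (vanishing (λ _ → refl)) (λ x → trans (f≈0 x) (sym (trans (+-identityˡ _) (zeroʳ x))))
  PolyFun-suc (horner a g g∈ f≈) = horner a g (PolyFun-suc g∈) f≈

  PolyFun-+ : ∀ {L f g} → PolyFun L f → PolyFun L g → PolyFun L (λ x → f x + g x)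
  PolyFun-+ (vanishing f≈0) (vanishing g≈0) = vanishing (λ x → trans (+-cong (f≈0 x) (g≈0 x)) (+-identityʳ 0#))
  PolyFun-+ (horner a f′ f′∈ f≈) (horner b g′ g′∈ g≈) = horner (a + b) (λ x → f′ x + g′ x) (PolyFun-+ f′∈ g′∈)
    (λ x → trans (+-cong (f≈ x) (g≈ x))
      (solve 5 (λ a b x F G → (a :+ x :* F) :+ (b :+ x :* G) := (a :+ b) :+ x :* (F :+ G)) refl a b x (f′ x) (g′ x)))

  PolyFun-scale : ∀ {L f} r → PolyFun L f → PolyFun L (λ x → r * f x)
  PolyFun-scale r (vanishing f≈0) = vanishing (λ x → trans (*-congˡ (f≈0 x)) (zeroʳ r))
  PolyFun-scale r (horner a g g∈ f≈) = horner (r * a) (λ x → r * g x) (PolyFun-scale r g∈)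
    (λ x → trans (*-congˡ (f≈ x)) (solve 4 (λ r a x G → r :* (a :+ x :* G) := r :* a :+ x :* (r :* G)) refl r a x (g x)))

  factor : ∀ {L f} → PolyFun (suc L) f → ∀ r →
           Σ (Carrier → Carrier) λ h → PolyFun L h × (∀ x → f x - f r ≈ (x - r) * h x)
  factor {zero} {f} (horner a g (vanishing g≈0) f≈) r = (λ _ → 0#) , vanishing (λ _ → refl) , λ x → begin
      f x - f r       ≈⟨ +-cong (constant x) (-‿cong (constant r)) ⟩
      a - a           ≈⟨ -‿inverseʳ a ⟩
      0#              ≈⟨ zeroʳ _ ⟨
      (x - r) * 0#    ∎
    where
    constant : ∀ x → f x ≈ a
    constant x = trans (f≈ x) (trans (+-congˡ (trans (*-congˡ (g≈0 x)) (zeroʳ x))) (+-identityʳ a))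
  factor {suc L} {f} (horner a g g∈ f≈) r with factor g∈ r
  ... | h , h∈ , g-factor = (λ x → g x + r * h x) , PolyFun-+ g∈ (PolyFun-scale r (PolyFun-suc h∈)) , λ x → begin
      f x - f r                                 ≈⟨ +-cong (f≈ x) (-‿cong (f≈ r)) ⟩
      (a + x * g x) - (a + r * g r)             ≈⟨ solve 5 (λ a x r G H → (a :+ x :* G) :- (a :+ r :* H) := (x :- r) :* G :+ r :* (G :- H)) refl a x r (g x) (g r) ⟩
      (x - r) * g x + r * (g x - g r)           ≈⟨ +-congˡ (*-congˡ (g-factor x)) ⟩
      (x - r) * g x + r * ((x - r) * h x)       ≈⟨ solve 4 (λ x r G H → (x :- r) :* G :+ r :* ((x :- r) :* H) := (x :- r) :* (G :+ r :* H)) refl x r (g x) (h x) ⟩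
      (x - r) * (g x + r * h x)                 ∎

  root-bound : ∀ {L f k} → PolyFun L f → (root : Fin k → Carrier) → (∀ i j → root i ≈ root j → i ≡ j)
    → (∀ i → f (root i) ≈ 0#) → L ≤ k → ∀ x → f x ≈ 0#
  root-bound (vanishing f≈0) root root-inj f-root L≤k x = f≈0 x
  root-bound {suc L} {f} {suc k} f∈ root root-inj f-root (s≤s L≤k) x with factor f∈ (root zero)
  ... | h , h∈ , f-factor = begin
      f x                      ≈⟨ solve 2 (λ a b → a := (a :- b) :+ b) refl (f x) (f r) ⟩
      (f x - f r) + f r        ≈⟨ +-cong (f-factor x) (f-root zero) ⟩
      (x - r) * h x + 0#       ≈⟨ +-identityʳ _ ⟩
      (x - r) * h x            ≈⟨ *-congˡ (h≈0 x) ⟩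
      (x - r) * 0#             ≈⟨ zeroʳ _ ⟩
      0#                       ∎
    where
    r : Carrier
    r = root zero
    h-root : ∀ i → h (root (suc i)) ≈ 0#
    h-root i = cancel-zero root≉r (trans (sym (f-factor (root (suc i))))
                                         (trans (+-cong (f-root (suc i)) (-‿cong (f-root zero))) (-‿inverseʳ 0#)))
      where
      root≉r : ¬ (root (suc i) - r) ≈ 0#
      root≉r e with root-inj (suc i) zero (difference-zero e)
      ... | ()
    h≈0 : ∀ x → h x ≈ 0#
    h≈0 = root-bound h∈ (root ∘ suc) (λ i j e → suc-injective (root-inj _ _ e)) h-root L≤k

  power-PolyFun : ∀ r → PolyFun (suc r) (_^ r)
  power-PolyFun zero    = horner 1# (λ _ → 0#) (vanishing (λ _ → refl)) (λ x → sym (trans (+-congˡ (zeroʳ x)) (+-identityʳ 1#)))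
  power-PolyFun (suc r) = horner 0# (_^ r) (power-PolyFun r) (λ x → sym (+-identityˡ _))

  -- if every nonzero element is an m-th root of unity then (q - 1) ∣ m: otherwise, for
  -- r + 1 = m mod (q - 1), the q - 1 nonzero elements are roots of x^(r+1) - 1, which has
  -- r + 2 ≤ q - 1 coefficients and so would vanish everywhere, also at 0
  roots-of-unity⇒∣ : ∀ m → (∀ i → enum i ≈ 0# ⊎ enum i ^ m ≈ 1#) → q' ∣ m
  roots-of-unity⇒∣ m all-roots with m % q' in m%q'≡
  ... | zero   = m%n≡0⇒n∣m m q' m%q'≡
  ... | suc r  = contradiction (root-bound x^[1+r]-1 nonzero nonzero-injective roots 2+r≤q' 0#) 0^[1+r]-1≉0
    where
    x^[1+r]-1 : PolyFun (suc (suc r)) (λ x → x ^ suc r - 1#)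
    x^[1+r]-1 = horner (- 1#) (_^ r) (power-PolyFun r) (λ x → +-comm _ _)
    m≡ : suc r ℕ.+ q' ℕ.* (m / q') ≡ m
    m≡ = ≡.sym (≡.trans (m≡m%n+[m/n]*n m q') (≡.cong₂ ℕ._+_ m%q'≡ (ℕ.*-comm (m / q') q')))
    roots : ∀ j → nonzero j ^ suc r - 1# ≈ 0#
    roots j with all-roots (punchIn zeroIndex j)
    ... | inj₁ x≈0 = contradiction x≈0 (nonzero-≉0 j)
    ... | inj₂ x^m≈1 = trans (+-congʳ x^[1+r]≈1) (-‿inverseʳ 1#)
      where
      x : Carrier
      x = nonzero j
      x^[1+r]≈1 : x ^ suc r ≈ 1#
      x^[1+r]≈1 = begin
        x ^ suc r                              ≈⟨ *-identityʳ _ ⟨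
        x ^ suc r * 1#                         ≈⟨ *-congˡ (fermat-multiple x (nonzero-≉0 j) (m / q')) ⟨
        x ^ suc r * x ^ (q' ℕ.* (m / q'))      ≈⟨ ^-homo-* x (suc r) _ ⟨
        x ^ (suc r ℕ.+ q' ℕ.* (m / q'))        ≡⟨ ≡.cong (x ^_) m≡ ⟩
        x ^ m                                  ≈⟨ x^m≈1 ⟩
        1#                                     ∎
    2+r≤q' : suc (suc r) ≤ q'
    2+r≤q' = ≡.subst (λ t → suc t ≤ q') m%q'≡ (m%n<n m q')
    0^[1+r]-1≉0 : ¬ (0# ^ suc r - 1#) ≈ 0#
    0^[1+r]-1≉0 e = -1≉0 (trans (sym (+-identityˡ _)) (trans (+-congʳ (sym (zeroˡ _))) e))

  powerSum : ℕ → Carrier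
  powerSum m = sum (λ i → enum i ^ m)

  powerSum-scale : ∀ d → ¬ d ≈ 0# → ∀ m → powerSum m ≈ d ^ m * powerSum m
  powerSum-scale d d≉0 m = begin
    powerSum m                           ≈⟨ ReindexSum.reindex (_^ m) (^-congˡ m) (scaling d d≉0) ⟩
    sum (λ i → (d * enum i) ^ m)         ≈⟨ sum-cong-≋ (λ i → ^-distrib-* d (enum i) m) ⟩
    sum (λ i → d ^ m * enum i ^ m)       ≈⟨ *-distribˡ-sum (d ^ m) (λ i → enum i ^ m) ⟨
    d ^ m * powerSum m                   ∎

  powerSum-translate : ∀ y m → sum (λ j → (enum j - y) ^ m) ≈ powerSum m
  powerSum-translate y m = sym (ReindexSum.reindex (_^ m) (^-congˡ m) (translation y))

  powerSum-reflect : ∀ y m → sum (λ j → (y - enum j) ^ m) ≈ powerSum m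
  powerSum-reflect y m = sym (ReindexSum.reindex (_^ m) (^-congˡ m) (reflection y))

  -- for m ≥ 1 a multiple of q - 1, every nonzero term is 1 and there are q - 1 ≡ -1 of them
  powerSum-∣ : q · 1# ≈ 0# → ∀ m → q' ∣ suc m → powerSum (suc m) ≈ - 1#
  powerSum-∣ q≈0 m (divides k 1+m≡k*q') = begin
    powerSum (suc m)                              ≈⟨ sum-remove {i = zeroIndex} (λ i → enum i ^ suc m) ⟩
    enum zeroIndex ^ suc m + sum (λ j → nonzero j ^ suc m)
      ≈⟨ +-cong (trans (^-congˡ (suc m) (enum-index 0#)) (zeroˡ _)) (sum-cong-≋ nonzero^[1+m]≈1) ⟩
    0# + sum {q'} (λ _ → 1#)                      ≈⟨ +-identityˡ _ ⟩
    sum {q'} (λ _ → 1#)                           ≈⟨ sum-replicate q' ⟩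
    q' · 1#                                       ≈⟨ inverseʳ-unique 1# (q' · 1#) q≈0 ⟩
    - 1#                                          ∎
    where
    nonzero^[1+m]≈1 : ∀ j → nonzero j ^ suc m ≈ 1#
    nonzero^[1+m]≈1 j = trans (reflexive (≡.cong (nonzero j ^_) (≡.trans 1+m≡k*q' (ℕ.*-comm k q'))))
                              (fermat-multiple (nonzero j) (nonzero-≉0 j) k)

  -- otherwise some nonzero y has y^m ≠ 1, and y^m · Σ x^m = Σ (y x)^m = Σ x^m forces the sum to vanish
  powerSum-∤ : ∀ m → ¬ q' ∣ m → powerSum m ≈ 0#
  powerSum-∤ m q'∤m with ¬∀⟶∃¬ q _ root-of-unity? (q'∤m ∘ roots-of-unity⇒∣ m)
    where
    root-of-unity? : ∀ i → Dec (enum i ≈ 0# ⊎ enum i ^ m ≈ 1#)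
    root-of-unity? i with enum i ≟ 0# | enum i ^ m ≟ 1#
    ... | yes x≈0 | _        = yes (inj₁ x≈0)
    ... | no _    | yes x^m≈1 = yes (inj₂ x^m≈1)
    ... | no x≉0  | no x^m≉1  = no λ { (inj₁ x≈0) → x≉0 x≈0 ; (inj₂ x^m≈1) → x^m≉1 x^m≈1 }
  ... | i , not-root = cancel-zero y^m-1≉0 (begin
      (y ^ m - 1#) * powerSum m                ≈⟨ [y-z]x≈yx-zx (powerSum m) (y ^ m) 1# ⟩
      y ^ m * powerSum m - 1# * powerSum m     ≈⟨ +-cong (sym (powerSum-scale y y≉0 m)) (-‿cong (*-identityˡ _)) ⟩
      powerSum m - powerSum m                  ≈⟨ -‿inverseʳ _ ⟩
      0#                                       ∎)
    where
    y : Carrier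
    y = enum i
    y≉0 : ¬ y ≈ 0#
    y≉0 = not-root ∘ inj₁
    y^m-1≉0 : ¬ (y ^ m - 1#) ≈ 0#
    y^m-1≉0 = not-root ∘ inj₂ ∘ difference-zero

-- Every law is checked on coefficients,
-- where the product becomes the convolution of coefficient sequences.
module Polynomials {c ℓ} (R : CommutativeRing c ℓ) where
  open CommutativeRing R
  open import Relation.Binary.Reasoning.Setoid setoid
  open import Algebra.Properties.Ring ring using (-1*x≈-x; -‿distribˡ-*)
  open import Algebra.Properties.Group +-group using (inverseʳ-unique)
  open import Algebra.Properties.Semiring.Exp semiring using (_^_)
  open import Algebra.Properties.CommutativeSemigroup +-commutativeSemigroup using (interchange; x∙yz≈y∙xz)

  infixl 6 _⊕_
  infixl 7 _⊛_
  infix 4 _≋_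

  _⊕_ _⊛_ : Poly R → Poly R → Poly R
  _⊕_ = _+ₚ_ R
  _⊛_ = _*ₚ_ R

  ⊝_ : Poly R → Poly R
  ⊝_ = scaleₚ R (- 1#)

  -- coefficientwise equality, wrapped in a record so that its arguments can be inferred
  record _≋_ (f g : Poly R) : Set ℓ where
    constructor mk≋
    field coeff≈ : _≈ₚ_ R f g
  open _≋_ public

  ≋-refl : ∀ {f} → f ≋ f
  ≋-refl = mk≋ λ n → refl

  ≋-sym : ∀ {f g} → f ≋ g → g ≋ f
  ≋-sym (mk≋ e) = mk≋ λ n → sym (e n)

  ≋-trans : ∀ {f g h} → f ≋ g → g ≋ h → f ≋ h
  ≋-trans (mk≋ e) (mk≋ e′) = mk≋ λ n → trans (e n) (e′ n)

  ∷-cong : ∀ {a b f g} → a ≈ b → f ≋ g → (a ∷ f) ≋ (b ∷ g)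
  ∷-cong a≈b (mk≋ e) = mk≋ λ { zero → a≈b ; (suc n) → e n }

  coeff-⊕ : ∀ f g n → coeff R (f ⊕ g) n ≈ coeff R f n + coeff R g n
  coeff-⊕ []      g       n       = sym (+-identityˡ _)
  coeff-⊕ (a ∷ f) []      n       = sym (+-identityʳ _)
  coeff-⊕ (a ∷ f) (b ∷ g) zero    = refl
  coeff-⊕ (a ∷ f) (b ∷ g) (suc n) = coeff-⊕ f g n

  coeff-scale : ∀ a f n → coeff R (scaleₚ R a f) n ≈ a * coeff R f n
  coeff-scale a []      n       = sym (zeroʳ a)
  coeff-scale a (b ∷ f) zero    = refl
  coeff-scale a (b ∷ f) (suc n) = coeff-scale a f n

  -- the convolution (F ⋆ G)(n) = Σ_{i+j=n} F(i) G(j) of coefficient sequences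
  _⋆_ : (ℕ → Carrier) → (ℕ → Carrier) → ℕ → Carrier
  (F ⋆ G) zero    = F 0 * G 0
  (F ⋆ G) (suc n) = F 0 * G (suc n) + ((F ∘ suc) ⋆ G) n

  ⋆-cong : ∀ {F F′ G G′} → (∀ n → F n ≈ F′ n) → (∀ n → G n ≈ G′ n) → ∀ n → (F ⋆ G) n ≈ (F′ ⋆ G′) n
  ⋆-cong F≈ G≈ zero    = *-cong (F≈ 0) (G≈ 0)
  ⋆-cong F≈ G≈ (suc n) = +-cong (*-cong (F≈ 0) (G≈ (suc n))) (⋆-cong (F≈ ∘ suc) G≈ n)

  ⋆-zeroˡ : ∀ {F} G → (∀ n → F n ≈ 0#) → ∀ n → (F ⋆ G) n ≈ 0#
  ⋆-zeroˡ G F≈0 zero    = trans (*-congʳ (F≈0 0)) (zeroˡ _)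
  ⋆-zeroˡ G F≈0 (suc n) = trans (+-cong (trans (*-congʳ (F≈0 0)) (zeroˡ _)) (⋆-zeroˡ G (F≈0 ∘ suc) n)) (+-identityʳ _)

  ⋆-distribˡ : ∀ F G H n → (F ⋆ (λ k → G k + H k)) n ≈ (F ⋆ G) n + (F ⋆ H) n
  ⋆-distribˡ F G H zero    = distribˡ _ _ _
  ⋆-distribˡ F G H (suc n) = trans (+-cong (distribˡ _ _ _) (⋆-distribˡ (F ∘ suc) G H n)) (interchange _ _ _ _)

  ⋆-distribʳ : ∀ F G H n → ((λ k → F k + G k) ⋆ H) n ≈ (F ⋆ H) n + (G ⋆ H) n
  ⋆-distribʳ F G H zero    = distribʳ _ _ _
  ⋆-distribʳ F G H (suc n) = trans (+-cong (distribʳ _ _ _) (⋆-distribʳ (F ∘ suc) (G ∘ suc) H n)) (interchange _ _ _ _)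

  ⋆-scaleˡ : ∀ a F G n → ((λ k → a * F k) ⋆ G) n ≈ a * (F ⋆ G) n
  ⋆-scaleˡ a F G zero    = *-assoc _ _ _
  ⋆-scaleˡ a F G (suc n) = trans (+-cong (*-assoc _ _ _) (⋆-scaleˡ a (F ∘ suc) G n)) (sym (distribˡ _ _ _))

  coeff-⊛ : ∀ f g n → coeff R (f ⊛ g) n ≈ (coeff R f ⋆ coeff R g) n
  coeff-⊛ []      g n       = sym (⋆-zeroˡ (coeff R g) (λ _ → refl) n)
  coeff-⊛ (a ∷ f) g zero    = trans (coeff-⊕ (scaleₚ R a g) _ 0) (trans (+-identityʳ _) (coeff-scale a g 0))
  coeff-⊛ (a ∷ f) g (suc n) = trans (coeff-⊕ (scaleₚ R a g) _ (suc n)) (+-cong (coeff-scale a g (suc n)) (coeff-⊛ f g n))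

  ⊕-cong : ∀ {f f′ g g′} → f ≋ f′ → g ≋ g′ → f ⊕ g ≋ f′ ⊕ g′
  ⊕-cong {f} {f′} {g} {g′} (mk≋ e) (mk≋ e′) =
    mk≋ λ n → trans (coeff-⊕ f g n) (trans (+-cong (e n) (e′ n)) (sym (coeff-⊕ f′ g′ n)))

  ⊛-cong : ∀ {f f′ g g′} → f ≋ f′ → g ≋ g′ → f ⊛ g ≋ f′ ⊛ g′
  ⊛-cong {f} {f′} {g} {g′} (mk≋ e) (mk≋ e′) =
    mk≋ λ n → trans (coeff-⊛ f g n) (trans (⋆-cong e e′ n) (sym (coeff-⊛ f′ g′ n)))

  scale-cong : ∀ {a b f g} → a ≈ b → f ≋ g → scaleₚ R a f ≋ scaleₚ R b g
  scale-cong {a} {b} {f} {g} a≈b (mk≋ e) =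
    mk≋ λ n → trans (coeff-scale a f n) (trans (*-cong a≈b (e n)) (sym (coeff-scale b g n)))

  ⊕-comm : ∀ f g → f ⊕ g ≋ g ⊕ f
  ⊕-comm f g = mk≋ λ n → trans (coeff-⊕ f g n) (trans (+-comm _ _) (sym (coeff-⊕ g f n)))

  ⊕-assoc : ∀ f g h → (f ⊕ g) ⊕ h ≋ f ⊕ (g ⊕ h)
  ⊕-assoc f g h = mk≋ λ n → begin
    coeff R ((f ⊕ g) ⊕ h) n                   ≈⟨ coeff-⊕ (f ⊕ g) h n ⟩
    coeff R (f ⊕ g) n + coeff R h n           ≈⟨ +-congʳ (coeff-⊕ f g n) ⟩
    coeff R f n + coeff R g n + coeff R h n   ≈⟨ +-assoc _ _ _ ⟩
    coeff R f n + (coeff R g n + coeff R h n) ≈⟨ +-congˡ (coeff-⊕ g h n) ⟨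
    coeff R f n + coeff R (g ⊕ h) n           ≈⟨ coeff-⊕ f (g ⊕ h) n ⟨
    coeff R (f ⊕ (g ⊕ h)) n                   ∎

  ⊕-identityʳ : ∀ f → f ⊕ [] ≋ f
  ⊕-identityʳ f = mk≋ λ n → trans (coeff-⊕ f [] n) (+-identityʳ _)

  ⊕-inverseˡ : ∀ f → (⊝ f) ⊕ f ≋ []
  ⊕-inverseˡ f = mk≋ λ n →
    trans (coeff-⊕ (⊝ f) f n) (trans (+-congʳ (trans (coeff-scale _ f n) (-1*x≈-x _))) (-‿inverseˡ _))

  ⊛-distribˡ : ∀ f g h → f ⊛ (g ⊕ h) ≋ f ⊛ g ⊕ f ⊛ h
  ⊛-distribˡ f g h = mk≋ λ n → begin
    coeff R (f ⊛ (g ⊕ h)) n                               ≈⟨ coeff-⊛ f (g ⊕ h) n ⟩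
    (coeff R f ⋆ coeff R (g ⊕ h)) n                       ≈⟨ ⋆-cong (λ _ → refl) (coeff-⊕ g h) n ⟩
    (coeff R f ⋆ (λ k → coeff R g k + coeff R h k)) n     ≈⟨ ⋆-distribˡ _ _ _ n ⟩
    (coeff R f ⋆ coeff R g) n + (coeff R f ⋆ coeff R h) n ≈⟨ +-cong (coeff-⊛ f g n) (coeff-⊛ f h n) ⟨
    coeff R (f ⊛ g) n + coeff R (f ⊛ h) n                 ≈⟨ coeff-⊕ (f ⊛ g) _ n ⟨
    coeff R (f ⊛ g ⊕ f ⊛ h) n                             ∎

  ⊛-distribʳ : ∀ h f g → (f ⊕ g) ⊛ h ≋ f ⊛ h ⊕ g ⊛ h
  ⊛-distribʳ h f g = mk≋ λ n → begin
    coeff R ((f ⊕ g) ⊛ h) n                               ≈⟨ coeff-⊛ (f ⊕ g) h n ⟩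
    (coeff R (f ⊕ g) ⋆ coeff R h) n                       ≈⟨ ⋆-cong (coeff-⊕ f g) (λ _ → refl) n ⟩
    ((λ k → coeff R f k + coeff R g k) ⋆ coeff R h) n     ≈⟨ ⋆-distribʳ _ _ _ n ⟩
    (coeff R f ⋆ coeff R h) n + (coeff R g ⋆ coeff R h) n ≈⟨ +-cong (coeff-⊛ f h n) (coeff-⊛ g h n) ⟨
    coeff R (f ⊛ h) n + coeff R (g ⊛ h) n                 ≈⟨ coeff-⊕ (f ⊛ h) _ n ⟨
    coeff R (f ⊛ h ⊕ g ⊛ h) n                             ∎

  scale-⊛ : ∀ a g h → scaleₚ R a g ⊛ h ≋ scaleₚ R a (g ⊛ h)
  scale-⊛ a g h = mk≋ λ n → begin
    coeff R (scaleₚ R a g ⊛ h) n             ≈⟨ coeff-⊛ (scaleₚ R a g) h n ⟩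
    (coeff R (scaleₚ R a g) ⋆ coeff R h) n   ≈⟨ ⋆-cong (coeff-scale a g) (λ _ → refl) n ⟩
    ((λ k → a * coeff R g k) ⋆ coeff R h) n  ≈⟨ ⋆-scaleˡ a _ _ n ⟩
    a * (coeff R g ⋆ coeff R h) n            ≈⟨ *-congˡ (coeff-⊛ g h n) ⟨
    a * coeff R (g ⊛ h) n                    ≈⟨ coeff-scale a (g ⊛ h) n ⟨
    coeff R (scaleₚ R a (g ⊛ h)) n           ∎

  shift-⊛ : ∀ f h → (0# ∷ f) ⊛ h ≋ (0# ∷ (f ⊛ h))
  shift-⊛ f h = mk≋ λ n →
    trans (coeff-⊕ (scaleₚ R 0# h) _ n) (trans (+-congʳ (trans (coeff-scale 0# h n) (zeroˡ _))) (+-identityˡ _))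

  ⊛-assoc : ∀ f g h → (f ⊛ g) ⊛ h ≋ f ⊛ (g ⊛ h)
  ⊛-assoc []      g h = ≋-refl
  ⊛-assoc (a ∷ f) g h = ≋-trans (⊛-distribʳ h (scaleₚ R a g) (0# ∷ (f ⊛ g)))
    (⊕-cong (scale-⊛ a g h) (≋-trans (shift-⊛ (f ⊛ g) h) (∷-cong refl (⊛-assoc f g h))))

  ⊛-zeroʳ : ∀ g → g ⊛ [] ≋ []
  ⊛-zeroʳ []      = ≋-refl
  ⊛-zeroʳ (b ∷ g) = mk≋ λ { zero → refl ; (suc n) → coeff≈ (⊛-zeroʳ g) n }

  ⊛-∷ʳ : ∀ g a f → g ⊛ (a ∷ f) ≋ scaleₚ R a g ⊕ (0# ∷ (g ⊛ f))
  ⊛-∷ʳ []      a f = mk≋ λ { zero → refl ; (suc n) → refl }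
  ⊛-∷ʳ (b ∷ g) a f = ≋-trans (∷-cong refl lhs-tail) (≋-sym (∷-cong (+-congʳ (*-comm a b)) rhs-tail))
    where
    -- after the common constant term b a, both sides are  b f + a g + t (g f)
    lhs-tail : scaleₚ R b f ⊕ (g ⊛ (a ∷ f)) ≋ scaleₚ R b f ⊕ (scaleₚ R a g ⊕ (0# ∷ (g ⊛ f)))
    lhs-tail = ⊕-cong ≋-refl (⊛-∷ʳ g a f)
    rhs-tail : scaleₚ R a g ⊕ (scaleₚ R b f ⊕ (0# ∷ (g ⊛ f))) ≋ scaleₚ R b f ⊕ (scaleₚ R a g ⊕ (0# ∷ (g ⊛ f)))
    rhs-tail = mk≋ λ n → begin
      coeff R (scaleₚ R a g ⊕ (scaleₚ R b f ⊕ t·gf)) n               ≈⟨ trans (coeff-⊕ (scaleₚ R a g) _ n) (+-congˡ (coeff-⊕ (scaleₚ R b f) t·gf n)) ⟩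
      coeff R (scaleₚ R a g) n + (coeff R (scaleₚ R b f) n + coeff R t·gf n) ≈⟨ x∙yz≈y∙xz _ _ _ ⟩
      coeff R (scaleₚ R b f) n + (coeff R (scaleₚ R a g) n + coeff R t·gf n) ≈⟨ trans (coeff-⊕ (scaleₚ R b f) _ n) (+-congˡ (coeff-⊕ (scaleₚ R a g) t·gf n)) ⟨
      coeff R (scaleₚ R b f ⊕ (scaleₚ R a g ⊕ t·gf)) n               ∎
      where
      t·gf : Poly R
      t·gf = 0# ∷ (g ⊛ f)

  ⊛-comm : ∀ f g → f ⊛ g ≋ g ⊛ f
  ⊛-comm []      g = ≋-sym (⊛-zeroʳ g)
  ⊛-comm (a ∷ f) g = ≋-trans (⊕-cong ≋-refl (∷-cong refl (⊛-comm f g))) (≋-sym (⊛-∷ʳ g a f))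

  ⊛-identityˡ : ∀ f → oneₚ R ⊛ f ≋ f
  ⊛-identityˡ f = mk≋ λ n →
    trans (coeff-⊕ (scaleₚ R 1# f) _ n) (trans (+-cong (coeff-scale 1# f n) (zero-poly n)) (trans (+-identityʳ _) (*-identityˡ _)))
    where
    zero-poly : ∀ n → coeff R (0# ∷ []) n ≈ 0#
    zero-poly zero    = refl
    zero-poly (suc n) = refl

  polynomialRing : CommutativeRing c ℓ
  polynomialRing = record
    { Carrier = Poly R ; _≈_ = _≋_ ; _+_ = _⊕_ ; _*_ = _⊛_ ; -_ = ⊝_ ; 0# = [] ; 1# = oneₚ R
    ; isCommutativeRing = record
      { isRing = record
        { +-isAbelianGroup = record
          { isGroup = record
            { isMonoid = record
              { isSemigroup = record
                { isMagma = record
                  { isEquivalence = record { refl = ≋-refl ; sym = ≋-sym ; trans = ≋-trans }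
                  ; ∙-cong = ⊕-cong }
                ; assoc = ⊕-assoc }
              ; identity = (λ f → ≋-refl) , ⊕-identityʳ }
            ; inverse = ⊕-inverseˡ , (λ f → ≋-trans (⊕-comm f (⊝ f)) (⊕-inverseˡ f))
            ; ⁻¹-cong = scale-cong refl }
          ; comm = ⊕-comm }
        ; *-cong = ⊛-cong
        ; *-assoc = ⊛-assoc
        ; *-identity = ⊛-identityˡ , (λ f → ≋-trans (⊛-comm f (oneₚ R)) (⊛-identityˡ f))
        ; distrib = ⊛-distribˡ , ⊛-distribʳ }
      ; *-comm = ⊛-comm } }

  constant-isRingHomomorphism : IsRingHomomorphism (CommutativeRing.rawRing R) (CommutativeRing.rawRing polynomialRing) (_∷ [])
  constant-isRingHomomorphism = record
    { isSemiringHomomorphism = record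
      { isNearSemiringHomomorphism = record
        { +-isMonoidHomomorphism = record
          { isMagmaHomomorphism = record
            { isRelHomomorphism = record { cong = λ a≈b → ∷-cong a≈b ≋-refl }
            ; homo = λ a b → ≋-refl }
          ; ε-homo = mk≋ λ { zero → refl ; (suc n) → refl } }
        ; *-homo = λ a b → ∷-cong (sym (+-identityʳ _)) ≋-refl }
      ; 1#-homo = ≋-refl }
    ; -‿homo = λ a → ∷-cong (sym (-1*x≈-x a)) ≋-refl }

  tPlus-difference : ∀ x y → tPlus R y ⊕ ⊝ tPlus R x ≋ (y - x) ∷ []
  tPlus-difference x y = mk≋ λ
    { zero          → +-congˡ (-1*x≈-x x)
    ; (suc zero)    → trans (+-congˡ (-1*x≈-x 1#)) (-‿inverseʳ 1#)
    ; (suc (suc n)) → refl }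

  coeff-beyond : ∀ f n → coeff R f (length f ℕ.+ n) ≈ 0#
  coeff-beyond []      n = refl
  coeff-beyond (a ∷ f) n = coeff-beyond f n

  -- t + θ is not a zero divisor: from (t + θ) f ≋ 0 the coefficients satisfy
  -- f(n) = -θ f(n+1), hence f(n) = (-θ)^j f(n+j) for every j, and f(n+j) = 0 for j large
  tPlus-⊛-zero : ∀ θ f → tPlus R θ ⊛ f ≋ [] → f ≋ []
  tPlus-⊛-zero θ f (mk≋ tf≈0) =
    mk≋ λ n → trans (iterate (length f) n) (trans (*-congˡ (coeff-beyond f n)) (zeroʳ _))
    where
    coeff-suc : ∀ n → coeff R (tPlus R θ ⊛ f) (suc n) ≈ θ * coeff R f (suc n) + coeff R f n
    coeff-suc n = trans (coeff-⊕ (scaleₚ R θ f) _ (suc n)) (+-cong (coeff-scale θ f (suc n)) (coeff≈ (⊛-identityˡ f) n))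
    step : ∀ n → coeff R f n ≈ (- θ) * coeff R f (suc n)
    step n = trans (inverseʳ-unique _ _ (trans (sym (coeff-suc n)) (tf≈0 (suc n)))) (-‿distribˡ-* θ _)
    iterate : ∀ j n → coeff R f n ≈ (- θ) ^ j * coeff R f (j ℕ.+ n)
    iterate zero    n = sym (*-identityˡ _)
    iterate (suc j) n = begin
      coeff R f n                                       ≈⟨ iterate j n ⟩
      (- θ) ^ j * coeff R f (j ℕ.+ n)                   ≈⟨ *-congˡ (step (j ℕ.+ n)) ⟩
      (- θ) ^ j * ((- θ) * coeff R f (suc (j ℕ.+ n)))   ≈⟨ *-assoc _ _ _ ⟨
      ((- θ) ^ j * (- θ)) * coeff R f (suc (j ℕ.+ n))   ≈⟨ *-congʳ (*-comm _ _) ⟩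
      (- θ) ^ suc j * coeff R f (suc j ℕ.+ n)           ∎

module Fractions {c ℓ} (P : CommutativeRing c ℓ) where
  open CommutativeRing P
  open import Relation.Binary.Reasoning.Setoid setoid
  open import Algebra.Properties.Ring ring using (-‿distribˡ-*; x[y-z]≈xy-xz)
  open IntegerSolver P using (solve; _:=_; _:+_; _:*_; _:-_; :-_; con)
  open import Algebra.Properties.Group +-group using (x∙y⁻¹≈ε⇒x≈y)

  Regular : Carrier → Set (c ⊔ ℓ)
  Regular d = ∀ x y → d * x ≈ d * y → x ≈ y

  1-regular : Regular 1#
  1-regular x y e = trans (sym (*-identityˡ x)) (trans e (*-identityˡ y))

  *-regular : ∀ {d e} → Regular d → Regular e → Regular (d * e)
  *-regular {d} {e} d-reg e-reg x y de·x≈de·y =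
    e-reg x y (d-reg _ _ (trans (sym (*-assoc d e x)) (trans de·x≈de·y (*-assoc d e y))))

  regular : ∀ {d} → (∀ x → d * x ≈ 0# → x ≈ 0#) → Regular d
  regular {d} no-zero-divisor x y dx≈dy = x∙y⁻¹≈ε⇒x≈y x y (no-zero-divisor (x - y) (begin
    d * (x - y)       ≈⟨ x[y-z]≈xy-xz d x y ⟩
    d * x - d * y     ≈⟨ +-congʳ dx≈dy ⟩
    d * y - d * y     ≈⟨ -‿inverseʳ _ ⟩
    0#                ∎))

  Fraction : Set (c ⊔ ℓ)
  Fraction = Σ (Carrier × Carrier) (Regular ∘ proj₂)

  num den : Fraction → Carrier
  num x = proj₁ (proj₁ x)
  den x = proj₂ (proj₁ x)

  infix 4 _≃_
  record _≃_ (x y : Fraction) : Set ℓ where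
    constructor mk≃
    field cross : num x * den y ≈ num y * den x
  open _≃_ public

  infixl 6 _⊕_
  infixl 7 _⊛_
  _⊕_ _⊛_ : Fraction → Fraction → Fraction
  ((n , d) , d-reg) ⊕ ((n′ , d′) , d′-reg) = (n * d′ + n′ * d , d * d′) , *-regular d-reg d′-reg
  ((n , d) , d-reg) ⊛ ((n′ , d′) , d′-reg) = (n * n′ , d * d′) , *-regular d-reg d′-reg

  ⊝_ : Fraction → Fraction
  ⊝ ((n , d) , d-reg) = (- n , d) , d-reg

  0f 1f : Fraction
  0f = (0# , 1#) , 1-regular
  1f = (1# , 1#) , 1-regular

  ≃-refl : ∀ {x} → x ≃ x
  ≃-refl = mk≃ refl

  ≃-sym : ∀ {x y} → x ≃ y → y ≃ x
  ≃-sym (mk≃ e) = mk≃ (sym e)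

  -- transitivity cancels the regular denominator of the middle fraction
  ≃-trans : ∀ {x y z} → x ≃ y → y ≃ z → x ≃ z
  ≃-trans {x} {y} {z} (mk≃ x≃y) (mk≃ y≃z) = mk≃ (proj₂ y _ _ (begin
    den y * (num x * den z)     ≈⟨ solve 3 (λ a b c → a :* (b :* c) := (b :* a) :* c) refl (den y) (num x) (den z) ⟩
    (num x * den y) * den z     ≈⟨ *-congʳ x≃y ⟩
    (num y * den x) * den z     ≈⟨ solve 3 (λ a b c → (a :* b) :* c := (a :* c) :* b) refl (num y) (den x) (den z) ⟩
    (num y * den z) * den x     ≈⟨ *-congʳ y≃z ⟩
    (num z * den y) * den x     ≈⟨ solve 3 (λ a b c → (a :* b) :* c := b :* (a :* c)) refl (num z) (den y) (den x) ⟩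
    den y * (num z * den x)     ∎))

  ⊕-cong : ∀ {x x′ y y′} → x ≃ x′ → y ≃ y′ → x ⊕ y ≃ x′ ⊕ y′
  ⊕-cong {x} {x′} {y} {y′} (mk≃ x≃x′) (mk≃ y≃y′) = mk≃ (begin
    (n₁ * d₂ + n₂ * d₁) * (d₁′ * d₂′)                  ≈⟨ solve 6 (λ n₁ d₁ n₂ d₂ d₁′ d₂′ → (n₁ :* d₂ :+ n₂ :* d₁) :* (d₁′ :* d₂′) := (n₁ :* d₁′) :* (d₂ :* d₂′) :+ (n₂ :* d₂′) :* (d₁ :* d₁′)) refl n₁ d₁ n₂ d₂ d₁′ d₂′ ⟩
    (n₁ * d₁′) * (d₂ * d₂′) + (n₂ * d₂′) * (d₁ * d₁′)  ≈⟨ +-cong (*-congʳ x≃x′) (*-congʳ y≃y′) ⟩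
    (n₁′ * d₁) * (d₂ * d₂′) + (n₂′ * d₂) * (d₁ * d₁′)  ≈⟨ solve 6 (λ n₁ d₁ n₂ d₂ d₁′ d₂′ → (n₁ :* d₁′) :* (d₂′ :* d₂) :+ (n₂ :* d₂′) :* (d₁′ :* d₁) := (n₁ :* d₂ :+ n₂ :* d₁) :* (d₁′ :* d₂′)) refl n₁′ d₁′ n₂′ d₂′ d₁ d₂ ⟩
    (n₁′ * d₂′ + n₂′ * d₁′) * (d₁ * d₂)                ∎)
    where
    n₁ d₁ n₂ d₂ n₁′ d₁′ n₂′ d₂′ : Carrier
    n₁ = num x
    d₁ = den x
    n₂ = num y
    d₂ = den y
    n₁′ = num x′
    d₁′ = den x′
    n₂′ = num y′
    d₂′ = den y′

  ⊛-cong : ∀ {x x′ y y′} → x ≃ x′ → y ≃ y′ → x ⊛ y ≃ x′ ⊛ y′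
  ⊛-cong {x} {x′} {y} {y′} (mk≃ x≃x′) (mk≃ y≃y′) = mk≃ (begin
    (num x * num y) * (den x′ * den y′)    ≈⟨ solve 4 (λ a b c d → (a :* b) :* (c :* d) := (a :* c) :* (b :* d)) refl (num x) (num y) (den x′) (den y′) ⟩
    (num x * den x′) * (num y * den y′)    ≈⟨ *-cong x≃x′ y≃y′ ⟩
    (num x′ * den x) * (num y′ * den y)    ≈⟨ solve 4 (λ a b c d → (a :* c) :* (b :* d) := (a :* b) :* (c :* d)) refl (num x′) (num y′) (den x) (den y) ⟩
    (num x′ * num y′) * (den x * den y)    ∎)

  ⊝-cong : ∀ {x y} → x ≃ y → ⊝ x ≃ ⊝ y
  ⊝-cong {x} {y} (mk≃ x≃y) = mk≃ (begin
    - num x * den y       ≈⟨ -‿distribˡ-* (num x) (den y) ⟨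
    - (num x * den y)     ≈⟨ -‿cong x≃y ⟩
    - (num y * den x)     ≈⟨ -‿distribˡ-* (num y) (den x) ⟩
    - num y * den x       ∎)

  ⊕-assoc : ∀ x y z → (x ⊕ y) ⊕ z ≃ x ⊕ (y ⊕ z)
  ⊕-assoc x y z = mk≃ (solve 6 (λ n₁ d₁ n₂ d₂ n₃ d₃ →
    ((n₁ :* d₂ :+ n₂ :* d₁) :* d₃ :+ n₃ :* (d₁ :* d₂)) :* (d₁ :* (d₂ :* d₃)) :=
    (n₁ :* (d₂ :* d₃) :+ (n₂ :* d₃ :+ n₃ :* d₂) :* d₁) :* ((d₁ :* d₂) :* d₃))
    refl (num x) (den x) (num y) (den y) (num z) (den z))

  ⊕-comm : ∀ x y → x ⊕ y ≃ y ⊕ x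
  ⊕-comm x y = mk≃ (solve 4 (λ n₁ d₁ n₂ d₂ → (n₁ :* d₂ :+ n₂ :* d₁) :* (d₂ :* d₁) := (n₂ :* d₁ :+ n₁ :* d₂) :* (d₁ :* d₂))
    refl (num x) (den x) (num y) (den y))

  ⊕-identityˡ : ∀ x → 0f ⊕ x ≃ x
  ⊕-identityˡ x = mk≃ (solve 3 (λ n d o → (con (ℤ.+ 0) :* d :+ n :* o) :* d := n :* (o :* d)) refl (num x) (den x) 1#)

  ⊕-inverseˡ : ∀ x → (⊝ x) ⊕ x ≃ 0f
  ⊕-inverseˡ x = mk≃ (solve 3 (λ n d o → (:- n :* d :+ n :* d) :* o := con (ℤ.+ 0) :* (d :* d)) refl (num x) (den x) 1#)

  ⊛-assoc : ∀ x y z → (x ⊛ y) ⊛ z ≃ x ⊛ (y ⊛ z)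
  ⊛-assoc x y z = mk≃ (solve 6 (λ n₁ d₁ n₂ d₂ n₃ d₃ →
    ((n₁ :* n₂) :* n₃) :* (d₁ :* (d₂ :* d₃)) := (n₁ :* (n₂ :* n₃)) :* ((d₁ :* d₂) :* d₃))
    refl (num x) (den x) (num y) (den y) (num z) (den z))

  ⊛-comm : ∀ x y → x ⊛ y ≃ y ⊛ x
  ⊛-comm x y = mk≃ (solve 4 (λ n₁ d₁ n₂ d₂ → (n₁ :* n₂) :* (d₂ :* d₁) := (n₂ :* n₁) :* (d₁ :* d₂))
    refl (num x) (den x) (num y) (den y))

  ⊛-identityˡ : ∀ x → 1f ⊛ x ≃ x
  ⊛-identityˡ x = mk≃ (solve 3 (λ n d o → (o :* n) :* d := n :* (o :* d)) refl (num x) (den x) 1#)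

  ⊛-distribˡ : ∀ x y z → x ⊛ (y ⊕ z) ≃ x ⊛ y ⊕ x ⊛ z
  ⊛-distribˡ x y z = mk≃ (solve 6 (λ n₁ d₁ n₂ d₂ n₃ d₃ →
    (n₁ :* (n₂ :* d₃ :+ n₃ :* d₂)) :* ((d₁ :* d₂) :* (d₁ :* d₃)) :=
    ((n₁ :* n₂) :* (d₁ :* d₃) :+ (n₁ :* n₃) :* (d₁ :* d₂)) :* (d₁ :* (d₂ :* d₃)))
    refl (num x) (den x) (num y) (den y) (num z) (den z))

  fractionRing : CommutativeRing (c ⊔ ℓ) ℓ
  fractionRing = record
    { Carrier = Fraction ; _≈_ = _≃_ ; _+_ = _⊕_ ; _*_ = _⊛_ ; -_ = ⊝_ ; 0# = 0f ; 1# = 1f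
    ; isCommutativeRing = record
      { isRing = record
        { +-isAbelianGroup = record
          { isGroup = record
            { isMonoid = record
              { isSemigroup = record
                { isMagma = record
                  { isEquivalence = record { refl = ≃-refl ; sym = ≃-sym ; trans = ≃-trans }
                  ; ∙-cong = ⊕-cong }
                ; assoc = ⊕-assoc }
              ; identity = ⊕-identityˡ , (λ x → ≃-trans (⊕-comm x 0f) (⊕-identityˡ x)) }
            ; inverse = ⊕-inverseˡ , (λ x → ≃-trans (⊕-comm x (⊝ x)) (⊕-inverseˡ x))
            ; ⁻¹-cong = ⊝-cong }
          ; comm = ⊕-comm }
        ; *-cong = ⊛-cong
        ; *-assoc = ⊛-assoc
        ; *-identity = ⊛-identityˡ , (λ x → ≃-trans (⊛-comm x 1f) (⊛-identityˡ x))
        ; distrib = ⊛-distribˡ , (λ x y z → ≃-trans (⊛-comm (y ⊕ z) x) (≃-trans (⊛-distribˡ x y z)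
                                             (⊕-cong (⊛-comm x y) (⊛-comm x z)))) }
      ; *-comm = ⊛-comm } }

  embed : Carrier → Fraction
  embed n = (n , 1#) , 1-regular

  embed-isRingHomomorphism : IsRingHomomorphism (CommutativeRing.rawRing P) (CommutativeRing.rawRing fractionRing) embed
  embed-isRingHomomorphism = record
    { isSemiringHomomorphism = record
      { isNearSemiringHomomorphism = record
        { +-isMonoidHomomorphism = record
          { isMagmaHomomorphism = record
            { isRelHomomorphism = record { cong = λ n≈m → mk≃ (*-congʳ n≈m) }
            ; homo = λ n m → mk≃ (solve 3 (λ n m o → (n :+ m) :* (o :* o) := (n :* o :+ m :* o) :* o) refl n m 1#) }
          ; ε-homo = ≃-refl }
        ; *-homo = λ n m → mk≃ (*-congˡ (*-identityˡ 1#)) }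
      ; 1#-homo = ≃-refl }
    ; -‿homo = λ n → ≃-refl }

  reciprocal : ∀ d → Regular d → Fraction
  reciprocal d d-reg = (1# , d) , d-reg

  reciprocal-difference : ∀ {a b c} (a-reg : Regular a) (b-reg : Regular b) → b - a ≈ c →
    reciprocal a a-reg ⊕ ⊝ reciprocal b b-reg ≃ embed c ⊛ (reciprocal a a-reg ⊛ reciprocal b b-reg)
  reciprocal-difference {a} {b} {c} _ _ b-a≈c = mk≃ (begin
    (1# * b + (- 1#) * a) * (1# * (a * b))   ≈⟨ solve 3 (λ a b o → (o :* b :+ (:- o) :* a) :* (o :* (a :* b)) := ((b :- a) :* (o :* o)) :* (a :* b)) refl a b 1# ⟩
    ((b - a) * (1# * 1#)) * (a * b)          ≈⟨ *-congʳ (*-congʳ b-a≈c) ⟩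
    (c * (1# * 1#)) * (a * b)                ∎)

module RationalFunctions {c ℓ} (R : CommutativeRing c ℓ) where
  open CommutativeRing R using (Carrier; _-_)
  open Polynomials R using (polynomialRing; constant-isRingHomomorphism; tPlus-difference; tPlus-⊛-zero)
  module P = CommutativeRing polynomialRing
  open Fractions polynomialRing public
  module K = CommutativeRing fractionRing
  open import Algebra.Properties.Semiring.Exp K.semiring using (_^_)

  tPlus-regular : ∀ θ → Regular (tPlus R θ)
  tPlus-regular θ = regular {tPlus R θ} (tPlus-⊛-zero θ)

  tPlus^-regular : ∀ θ s → Regular (_^ₚ_ R (tPlus R θ) s)
  tPlus^-regular θ zero    = 1-regular
  tPlus^-regular θ (suc s) = *-regular {tPlus R θ} {_^ₚ_ R (tPlus R θ) s} (tPlus-regular θ) (tPlus^-regular θ s)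

  constant : Carrier → Fraction
  constant = embed ∘ (_∷ [])

  constant-isRingHomomorphism′ : IsRingHomomorphism (CommutativeRing.rawRing R) K.rawRing constant
  constant-isRingHomomorphism′ = isRingHomomorphism ≃-trans constant-isRingHomomorphism embed-isRingHomomorphism

  u : Carrier → Fraction
  u θ = reciprocal (tPlus R θ) (tPlus-regular θ)

  uPow : Carrier → ℕ → Fraction
  uPow θ s = reciprocal (_^ₚ_ R (tPlus R θ) s) (tPlus^-regular θ s)

  num-u^ : ∀ θ s → num (u θ ^ s) P.≈ P.1#
  num-u^ θ zero    = P.refl
  num-u^ θ (suc s) = P.trans (P.*-identityˡ _) (num-u^ θ s)

  den-u^ : ∀ θ s → den (u θ ^ s) P.≈ _^ₚ_ R (tPlus R θ) s
  den-u^ θ zero    = P.refl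
  den-u^ θ (suc s) = P.*-congˡ {tPlus R θ} (den-u^ θ s)

  uPow≃u^ : ∀ θ s → uPow θ s ≃ u θ ^ s
  uPow≃u^ θ s = mk≃ (P.*-cong (P.sym (num-u^ θ s)) (den-u^ θ s))

  u-difference : ∀ x y → u x K.- u y ≃ constant (y - x) K.* (u x K.* u y)
  u-difference x y =
    reciprocal-difference {tPlus R x} {tPlus R y} {(y - x) ∷ []} (tPlus-regular x) (tPlus-regular y) (tPlus-difference x y)

module HomomorphismLemmas {c ℓ c′ ℓ′} (R : CommutativeRing c ℓ) (K : CommutativeRing c′ ℓ′)
  (ι : CommutativeRing.Carrier R → CommutativeRing.Carrier K)
  (ι-hom : IsRingHomomorphism (CommutativeRing.rawRing R) (CommutativeRing.rawRing K) ι) where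
  private module R = CommutativeRing R
  open CommutativeRing K
  open IsRingHomomorphism ι-hom public using (⟦⟧-cong; +-homo; *-homo; 0#-homo; 1#-homo; -‿homo)
  open import Algebra.Properties.Semiring.Exp R.semiring using () renaming (_^_ to _^ᴿ_)
  open import Algebra.Properties.Semiring.Exp semiring using (_^_)
  open import Algebra.Definitions.RawMonoid R.+-rawMonoid using () renaming (_×_ to _·ᴿ_)
  open import Algebra.Definitions.RawMonoid +-rawMonoid using () renaming (_×_ to _·_)
  private module SumR = CommutativeMonoidSum R.+-commutativeMonoid
  open CommutativeMonoidSum +-commutativeMonoid using (sum)

  ι-^ : ∀ x n → ι (x ^ᴿ n) ≈ ι x ^ n
  ι-^ x zero    = 1#-homo
  ι-^ x (suc n) = trans (*-homo _ _) (*-congˡ (ι-^ x n))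

  ι-· : ∀ n x → ι (n ·ᴿ x) ≈ n · ι x
  ι-· zero    x = 0#-homo
  ι-· (suc n) x = trans (+-homo _ _) (+-congˡ (ι-· n x))

  ι-sum : ∀ {n} (g : Fin n → R.Carrier) → ι (SumR.sum g) ≈ sum (ι ∘ g)
  ι-sum {zero}  g = 0#-homo
  ι-sum {suc n} g = trans (+-homo _ _) (+-congˡ (ι-sum (g ∘ suc)))

-- (q' - 1) n + s ≡ -(n - s) modulo q', so q' ∣ (q' - 1) n + s gives q' ∣ n - s in ℤ
∣-shift : ∀ q' n s → 1 ≤ q' → q' ∣ (q' ∸ 1) ℕ.* n ℕ.+ s → (+ q') ∣ℤ (+ n -ℤ + s)
∣-shift q' n s 1≤q' q'∣X = ∣⇒∣ᵤ (≡.subst (+ q' ∣ₛ_) q'n-X≡n-s (∣m∣n⇒∣m-n (∣m⇒∣m*n (+ n) ∣-refl) (∣ᵤ⇒∣ q'∣X)))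
  where
  open ≡.≡-Reasoning
  open +-*-Solver
  q'n-X≡n-s : + q' ℤ.* + n -ℤ + ((q' ∸ 1) ℕ.* n ℕ.+ s) ≡ + n -ℤ + s
  q'n-X≡n-s = begin
    + q' ℤ.* + n -ℤ + ((q' ∸ 1) ℕ.* n ℕ.+ s)          ≡⟨ ≡.cong (λ x → + q' ℤ.* + n -ℤ x) (≡.trans (pos-+ _ s) (≡.cong (ℤ._+ + s) (pos-* (q' ∸ 1) n))) ⟩
    + q' ℤ.* + n -ℤ (+ (q' ∸ 1) ℤ.* + n ℤ.+ + s)      ≡⟨ ≡.cong (λ x → + q' ℤ.* + n -ℤ (x ℤ.* + n ℤ.+ + s)) (≡.trans (≡.sym (⊖-≥ 1≤q')) (≡.sym (m-n≡m⊖n q' 1))) ⟩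
    + q' ℤ.* + n -ℤ ((+ q' -ℤ + 1) ℤ.* + n ℤ.+ + s)    ≡⟨ solve 3 (λ Q N S → Q :* N :- ((Q :- con (+ 1)) :* N :+ S) := N :- S) ≡.refl (+ q') (+ n) (+ s) ⟩
    + n -ℤ + s                                        ∎

module ProductFormula {c ℓ c′ ℓ′} (R : CommutativeRing c ℓ) (q' : ℕ) {{_ : NonZero q'}}
  (F : IsFiniteField R (suc q')) (p : ℕ) {{_ : NonZero p}} (K : CommutativeRing c′ ℓ′)
  (ι : CommutativeRing.Carrier R → CommutativeRing.Carrier K)
  (ι-hom : IsRingHomomorphism (CommutativeRing.rawRing R) (CommutativeRing.rawRing K) ι)
  (u : Fin (suc q') → CommutativeRing.Carrier K)
  (u-difference : ∀ i j → CommutativeRing._≈_ K (CommutativeRing._-_ K (u i) (u j))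
    (CommutativeRing._*_ K (ι (CommutativeRing._-_ R (IsFiniteField.enum F j) (IsFiniteField.enum F i)))
                           (CommutativeRing._*_ K (u i) (u j)))) where
  private module R = CommutativeRing R
  open CommutativeRing K hiding (zero)
  open IsFiniteField F using (enum; enum-inj)
  open import Relation.Binary.Reasoning.Setoid setoid
  open import Algebra.Properties.Semiring.Exp R.semiring using () renaming (_^_ to _^ᴿ_; ^-homo-* to ^ᴿ-homo-*; ^-congʳ to ^ᴿ-congʳ)
  open import Algebra.Properties.Semiring.Exp semiring using (_^_; ^-homo-*)
  open import Algebra.Definitions.RawMonoid R.+-rawMonoid using () renaming (_×_ to _·ᴿ_)
  open import Algebra.Definitions.RawMonoid +-rawMonoid using () renaming (_×_ to _·_)
  open import Algebra.Properties.Monoid.Mult +-monoid using (×-homo-+; ×-assocˡ; ×-congʳ)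
  open import Algebra.Properties.Semiring.Mult semiring using (×-assoc-*)
  open import Algebra.Properties.Ring ring using (-‿distribʳ-*)
  open CommutativeMonoidSum +-commutativeMonoid using (sum; sum-cong-≋)
  open FiniteField R q' F using (q; powerSum; powerSum-translate; powerSum-reflect; powerSum-∣; powerSum-∤; fermat-multiple; difference-zero)
  open HomomorphismLemmas R K ι ι-hom
  open DoubleSums K
  open RangeSum K
  open PartialFractions K p using (coeffᵤ; coeffᵥ; term; partialFractions)
  open Characteristic K p using ([p-1]·≈-; ·-mod)

  S : ℕ → Carrier
  S s = sum (λ i → u i ^ s)

  combination : List (ℕ × ℕ) → Carrier
  combination []            = 0#
  combination ((f , s) ∷ L) = f · S s + combination L

  Admissible : ℕ → ℕ × ℕ → Set
  Admissible n x = proj₁ x < p × 1 ≤ proj₂ x × (+ q') ∣ℤ ((+ n) -ℤ (+ proj₂ x))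

  ·-as-* : ∀ n x → n · x ≈ (n · 1#) * x
  ·-as-* n x = sym (trans (×-assoc-* n 1# x) (×-congʳ n (*-identityˡ x)))

  module _ (q·1≈0 : q ·ᴿ R.1# R.≈ R.0#) (p·1≈0 : p ·ᴿ R.1# R.≈ R.0#) where

    p·1≈0ᴷ : p · 1# ≈ 0#
    p·1≈0ᴷ = trans (sym (trans (ι-· p R.1#) (×-congʳ p 1#-homo))) (trans (⟦⟧-cong p·1≈0) 0#-homo)

    module _ (a b : ℕ) (1≤a+b : 1 ≤ a ℕ.+ b) where

      n : ℕ
      n = a ℕ.+ b

      e : ℕ
      e = (q' ∸ 1) ℕ.* n

      m : ℕ → ℕ
      m k = e ℕ.+ suc k

      e+n≡q'n : e ℕ.+ n ≡ q' ℕ.* n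
      e+n≡q'n = ≡.trans (≡.cong (e ℕ.+_) (≡.sym (ℕ.*-identityˡ n)))
                  (≡.trans (≡.sym (ℕ.*-distribʳ-+ n (q' ∸ 1) 1)) (≡.cong (ℕ._* n) (ℕ.m∸n+n≡m (ℕ.>-nonZero⁻¹ q'))))

      ι-^-split : ∀ x k → ι (x ^ᴿ e) * ι x ^ k ≈ ι (x ^ᴿ (e ℕ.+ k))
      ι-^-split x k = begin
        ι (x ^ᴿ e) * ι x ^ k          ≈⟨ *-congˡ (ι-^ x k) ⟨
        ι (x ^ᴿ e) * ι (x ^ᴿ k)       ≈⟨ *-homo _ _ ⟨
        ι (x ^ᴿ e R.* x ^ᴿ k)         ≈⟨ ⟦⟧-cong (R.sym (^ᴿ-homo-* x e k)) ⟩
        ι (x ^ᴿ (e ℕ.+ k))            ∎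

      ι-^-inverse : ∀ x → ¬ x R.≈ R.0# → ι (x ^ᴿ e) * ι x ^ n ≈ 1#
      ι-^-inverse x x≉0 = begin
        ι (x ^ᴿ e) * ι x ^ n          ≈⟨ ι-^-split x n ⟩
        ι (x ^ᴿ (e ℕ.+ n))            ≈⟨ ⟦⟧-cong (^ᴿ-congʳ x e+n≡q'n) ⟩
        ι (x ^ᴿ (q' ℕ.* n))           ≈⟨ ⟦⟧-cong (fermat-multiple x x≉0 n) ⟩
        ι R.1#                        ≈⟨ 1#-homo ⟩
        1#                            ∎

      d : Fin q → Fin q → R.Carrier
      d i j = enum j R.- enum i

      summand : ℕ → Fin q → Fin q → Carrier
      summand k i j = ι (d i j ^ᴿ m k) * (coeffᵤ a b k · u i ^ suc k + coeffᵥ a b k · u j ^ suc k)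

      h G : Fin q → Fin q → Carrier
      h i j = u i ^ a * u j ^ b
      G i j = ∑< n (λ k → summand k i j)

      -- off the diagonal, h = G: expand by partial fractions and multiply by ι(d^e) ι(d)^n = 1
      h≈G : ∀ i j → i ≢ j → h i j ≈ G i j
      h≈G i j i≢j = begin
        h i j                                               ≈⟨ *-identityˡ _ ⟨
        1# * h i j                                          ≈⟨ *-congʳ (ι-^-inverse (d i j) d≉0) ⟨
        ι (d i j ^ᴿ e) * dᴷ ^ n * h i j                     ≈⟨ *-assoc _ _ _ ⟩
        ι (d i j ^ᴿ e) * (dᴷ ^ n * h i j)
          ≈⟨ *-congˡ (partialFractions p·1≈0ᴷ dᴷ (u i) (u j) (u-difference i j) n a b 1≤a+b ℕ.≤-refl) ⟩
        ι (d i j ^ᴿ e) * ∑< n (term dᴷ (u i) (u j) a b)     ≈⟨ ∑<-distribˡ n _ _ ⟩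
        ∑< n (λ k → ι (d i j ^ᴿ e) * term dᴷ (u i) (u j) a b k)
          ≈⟨ ∑<-cong n (λ k → trans (sym (*-assoc _ _ _)) (*-congʳ (ι-^-split (d i j) (suc k)))) ⟩
        G i j                                               ∎
        where
        dᴷ : Carrier
        dᴷ = ι (d i j)
        d≉0 : ¬ d i j R.≈ R.0#
        d≉0 d≈0 = i≢j (≡.sym (enum-inj _ _ (difference-zero d≈0)))

      -- on the diagonal d = 0 and every exponent m(k) is positive
      G-diagonal : ∀ i → G i i ≈ 0#
      G-diagonal i = ∑<-zero n _ (λ k _ → trans (*-congʳ (trans (⟦⟧-cong (d^m≈0 k)) 0#-homo)) (zeroˡ _))
        where
        d^m≈0 : ∀ k → d i i ^ᴿ m k R.≈ R.0#
        d^m≈0 k = R.trans (^ᴿ-congʳ (d i i) (ℕ.+-suc e k))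
                          (R.trans (R.*-congʳ (R.-‿inverseʳ (enum i))) (R.zeroˡ _))

      expand : S a * S b - S n ≈ sum (λ i → sum (G i))
      expand = begin
        S a * S b - S n
          ≈⟨ +-cong (sum-*-sum (λ i → u i ^ a) (λ j → u j ^ b)) (-‿cong (sum-cong-≋ (λ i → ^-homo-* (u i) a b))) ⟩
        sum (λ i → sum (h i)) - sum (λ i → h i i)
          ≈⟨ off-diagonal h G h≈G G-diagonal ⟩
        sum (λ i → sum (G i))
          ∎

      -- the k-th term: after summing over i and j the powers of the differences become power sums
      Φ : ℕ → Carrier
      Φ k = ((coeffᵤ a b k ℕ.+ coeffᵥ a b k) · 1#) * (S (suc k) * ι (powerSum (m k)))

      Φ-double-sum : ∀ k → sum (λ i → sum (summand k i)) ≈ Φ k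
      Φ-double-sum k = begin
        sum (λ i → sum (λ j → D i j * (A · w i + B · w j)))
          ≈⟨ sum-cong-≋ (λ i → sum-cong-≋ (λ j → *-congˡ {D i j} (+-cong (·-as-* A (w i)) (·-as-* B (w j))))) ⟩
        sum (λ i → sum (λ j → D i j * ((A · 1#) * w i + (B · 1#) * w j)))
          ≈⟨ balanced-sum D (ι (powerSum (m k))) (A · 1#) (B · 1#) w rows columns ⟩
        ((A · 1#) + (B · 1#)) * (S (suc k) * ι (powerSum (m k)))
          ≈⟨ *-congʳ (×-homo-+ 1# A B) ⟨
        Φ k
          ∎
        where
        A B : ℕ
        A = coeffᵤ a b k
        B = coeffᵥ a b k
        w : Fin q → Carrier
        w i = u i ^ suc k
        D : Fin q → Fin q → Carrier
        D i j = ι (d i j ^ᴿ m k)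
        rows : ∀ i → sum (D i) ≈ ι (powerSum (m k))
        rows i = trans (sym (ι-sum (λ j → d i j ^ᴿ m k))) (⟦⟧-cong (powerSum-translate (enum i) (m k)))
        columns : ∀ j → sum (λ i → D i j) ≈ ι (powerSum (m k))
        columns j = trans (sym (ι-sum (λ i → d i j ^ᴿ m k))) (⟦⟧-cong (powerSum-reflect (enum j) (m k)))

      collect : sum (λ i → sum (G i)) ≈ ∑< n Φ
      collect = begin
        sum (λ i → sum (G i))
          ≈⟨ sum-cong-≋ (λ i → sum-∑< n (λ j k → summand k i j)) ⟩
        sum (λ i → ∑< n (λ k → sum (summand k i)))
          ≈⟨ sum-∑< n (λ i k → sum (summand k i)) ⟩
        ∑< n (λ k → sum (λ i → sum (summand k i)))
          ≈⟨ ∑<-cong n Φ-double-sum ⟩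
        ∑< n Φ
          ∎

      -- the coefficient -(A_k + B_k) of S(k+1), as a residue modulo p
      coefficient : ℕ → ℕ
      coefficient k = ((p ∸ 1) ℕ.* (coeffᵤ a b k ℕ.+ coeffᵥ a b k)) % p

      -- if (q - 1) ∣ m(k) the power sum is -1 and Φ(k) = -(A_k + B_k) S(k+1); otherwise it is 0
      Φ-∣ : ∀ k → q' ∣ m k → Φ k ≈ coefficient k · S (suc k)
      Φ-∣ k q'∣m = begin
        (t · 1#) * (S (suc k) * ι (powerSum (m k)))   ≈⟨ *-congˡ (*-congˡ ι-powerSum) ⟩
        (t · 1#) * (S (suc k) * - 1#)                 ≈⟨ *-congˡ (trans (-‿cong (sym (*-identityʳ _))) (-‿distribʳ-* _ 1#)) ⟨
        (t · 1#) * - S (suc k)                        ≈⟨ -‿distribʳ-* _ _ ⟨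
        - ((t · 1#) * S (suc k))                      ≈⟨ -‿cong (·-as-* t (S (suc k))) ⟨
        - (t · S (suc k))                             ≈⟨ [p-1]·≈- p·1≈0ᴷ _ ⟨
        (p ∸ 1) · (t · S (suc k))                     ≈⟨ ×-assocˡ (S (suc k)) (p ∸ 1) t ⟩
        ((p ∸ 1) ℕ.* t) · S (suc k)                   ≈⟨ ·-mod p·1≈0ᴷ _ _ ⟨
        coefficient k · S (suc k)                     ∎
        where
        t : ℕ
        t = coeffᵤ a b k ℕ.+ coeffᵥ a b k
        m≡ : m k ≡ suc (e ℕ.+ k)
        m≡ = ℕ.+-suc e k
        ι-powerSum : ι (powerSum (m k)) ≈ - 1#
        ι-powerSum = begin
          ι (powerSum (m k))             ≈⟨ ⟦⟧-cong (R.reflexive (≡.cong powerSum m≡)) ⟩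
          ι (powerSum (suc (e ℕ.+ k)))   ≈⟨ ⟦⟧-cong (powerSum-∣ q·1≈0 _ (≡.subst (q' ∣_) m≡ q'∣m)) ⟩
          ι (R.- R.1#)                   ≈⟨ -‿homo R.1# ⟩
          - ι R.1#                       ≈⟨ -‿cong 1#-homo ⟩
          - 1#                           ∎

      Φ-∤ : ∀ k → ¬ q' ∣ m k → Φ k ≈ 0#
      Φ-∤ k q'∤m = trans (*-congˡ (trans (*-congˡ (trans (⟦⟧-cong (powerSum-∤ (m k) q'∤m)) 0#-homo)) (zeroʳ _))) (zeroʳ _)

      terms : ℕ → List (ℕ × ℕ)
      terms zero    = []
      terms (suc k) with q' ∣? m k
      ... | yes _ = (coefficient k , suc k) ∷ terms k
      ... | no  _ = terms k

      ∑<-terms : ∀ N → ∑< N Φ ≈ combination (terms N)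
      ∑<-terms zero    = refl
      ∑<-terms (suc k) with q' ∣? m k
      ... | yes q'∣m = +-cong (Φ-∣ k q'∣m) (∑<-terms k)
      ... | no  q'∤m = trans (+-cong (Φ-∤ k q'∤m) (∑<-terms k)) (+-identityˡ _)

      terms-admissible : ∀ N → All (Admissible n) (terms N)
      terms-admissible zero    = []
      terms-admissible (suc k) with q' ∣? m k
      ... | yes q'∣m = (m%n<n _ p , s≤s z≤n , ∣-shift q' n (suc k) (ℕ.>-nonZero⁻¹ q') q'∣m) ∷ terms-admissible k
      ... | no  _    = terms-admissible k

      productFormula : ∃ λ L → All (Admissible n) L × (S a * S b - S n ≈ combination L)
      productFormula = terms n , terms-admissible n , trans expand (trans collect (∑<-terms n))

module NaturalMultiples {c ℓ} (R : CommutativeRing c ℓ) where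
  open CommutativeRing R
  open import Algebra.Definitions.RawMonoid +-rawMonoid using () renaming (_×_ to _·_)
  open import Algebra.Properties.Semiring.Mult semiring using (×1-homo-*)

  natMul≡· : ∀ n x → natMul R n x ≡ n · x
  natMul≡· zero    x = ≡.refl
  natMul≡· (suc n) x = ≡.cong (_+_ x) (natMul≡· n x)

  power-char : ∀ p n q → q ≡ p ℕ.^ suc n → natMul R p 1# ≈ 0# → natMul R q 1# ≈ 0#
  power-char p n q q≡p^n p·1≈0 = begin
    natMul R q 1#               ≡⟨ ≡.trans (natMul≡· q 1#) (≡.cong (_· 1#) q≡p^n) ⟩
    (p ℕ.* p ℕ.^ n) · 1#        ≈⟨ ×1-homo-* p (p ℕ.^ n) ⟩
    (p · 1#) * (p ℕ.^ n) · 1#   ≈⟨ *-congʳ (≡.subst (_≈ 0#) (natMul≡· p 1#) p·1≈0) ⟩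
    0# * (p ℕ.^ n) · 1#         ≈⟨ zeroˡ _ ⟩
    0#                          ∎
    where open import Relation.Binary.Reasoning.Setoid setoid

module ToStatement {c ℓ} (R : CommutativeRing c ℓ) where
  open RationalFunctions R
  open CommutativeMonoidSum K.+-commutativeMonoid using (sum)
  open import Algebra.Definitions.RawMonoid K.+-rawMonoid using () renaming (_×_ to _·_)

  proj₁-sum : ∀ {N} (g : Fin N → Fraction) → proj₁ (sum g) ≡ sumFin R (proj₁ ∘ g)
  proj₁-sum {zero}  g = ≡.refl
  proj₁-sum {suc N} g = ≡.cong (_+f_ R (proj₁ (g zero))) (proj₁-sum (g ∘ suc))

  proj₁-· : ∀ f x → proj₁ (f · x) ≡ natMulF R f (proj₁ x)
  proj₁-· zero    x = ≡.refl
  proj₁-· (suc f) x = ≡.cong (_+f_ R (proj₁ x)) (proj₁-· f x)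

  ≃⇒≈f : ∀ {x y} → x ≃ y → _≈f_ R (proj₁ x) (proj₁ y)
  ≃⇒≈f x≃y = coeff≈ (cross x≃y)
    where open Polynomials R using (coeff≈)

module DegreeOneProducts {c ℓ} (R : CommutativeRing c ℓ) (q' : ℕ) {{_ : NonZero q'}} (F : IsFiniteField R (suc q'))
                         (p : ℕ) {{_ : NonZero p}} where
  open CommutativeRing R using (_≈_; 1#; 0#)
  open IsFiniteField F using (enum)
  open RationalFunctions R
  open ToStatement R
  open NaturalMultiples R using (natMul≡·)
  open ProductFormula R q' F p fractionRing constant constant-isRingHomomorphism′ (u ∘ enum)
                      (λ i j → u-difference (enum i) (enum j))
  open CommutativeMonoidSum K.+-commutativeMonoid using (sum; sum-cong-≋)
  open import Algebra.Definitions.RawMonoid K.+-rawMonoid using () renaming (_×_ to _·_)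
  open import Algebra.Properties.Monoid.Mult K.+-monoid using (×-congʳ)

  S₁ᶠ : ℕ → Fraction
  S₁ᶠ s = sum (λ i → uPow (enum i) s)

  combinationᶠ : List (ℕ × ℕ) → Fraction
  combinationᶠ []            = 0f
  combinationᶠ ((f , s) ∷ L) = f · S₁ᶠ s ⊕ combinationᶠ L

  S₁ᶠ≃S : ∀ s → S₁ᶠ s ≃ S s
  S₁ᶠ≃S s = sum-cong-≋ (λ i → uPow≃u^ (enum i) s)

  combination≃ : ∀ L → combination L ≃ combinationᶠ L
  combination≃ []            = ≃-refl
  combination≃ ((f , s) ∷ L) = ⊕-cong (×-congʳ f (≃-sym (S₁ᶠ≃S s))) (combination≃ L)

  proj₁-S₁ᶠ : ∀ s → proj₁ (S₁ᶠ s) ≡ S₁ R enum s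
  proj₁-S₁ᶠ s = proj₁-sum (λ i → uPow (enum i) s)

  proj₁-combinationᶠ : ∀ L → proj₁ (combinationᶠ L) ≡ linComb R enum L
  proj₁-combinationᶠ []            = ≡.refl
  proj₁-combinationᶠ ((f , s) ∷ L) =
    ≡.cong₂ (_+f_ R) (≡.trans (proj₁-· f (S₁ᶠ s)) (≡.cong (natMulF R f) (proj₁-S₁ᶠ s))) (proj₁-combinationᶠ L)

  toStatement : ∀ a b L → S₁ᶠ a ⊛ S₁ᶠ b ⊕ ⊝ S₁ᶠ (a ℕ.+ b) ≃ combinationᶠ L →
    _≈f_ R (_+f_ R (_*f_ R (S₁ R enum a) (S₁ R enum b)) (negᶠ R (S₁ R enum (a ℕ.+ b)))) (linComb R enum L)
  toStatement a b L e = ≡.subst₂ (_≈f_ R) {proj₁ lhs} {_+f_ R (_*f_ R (S₁ R enum a) (S₁ R enum b)) (negᶠ R (S₁ R enum (a ℕ.+ b)))}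
                                {proj₁ (combinationᶠ L)} {linComb R enum L}
                                (≡.cong₂ (_+f_ R) (≡.cong₂ (_*f_ R) (proj₁-S₁ᶠ a) (proj₁-S₁ᶠ b)) (≡.cong (negᶠ R) (proj₁-S₁ᶠ (a ℕ.+ b))))
                                (proj₁-combinationᶠ L) (≃⇒≈f {lhs} {combinationᶠ L} e)
    where
    lhs : Fraction
    lhs = S₁ᶠ a ⊛ S₁ᶠ b ⊕ ⊝ S₁ᶠ (a ℕ.+ b)

  theorem : natMul R (suc q') 1# ≈ 0# → natMul R p 1# ≈ 0# → ∀ a b → 1 ≤ a ℕ.+ b →
    ∃ λ (L : List (ℕ × ℕ)) → All (Admissible (a ℕ.+ b)) L ×
      _≈f_ R (_+f_ R (_*f_ R (S₁ R enum a) (S₁ R enum b)) (negᶠ R (S₁ R enum (a ℕ.+ b)))) (linComb R enum L)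
  theorem q·1≈0 p·1≈0 a b 1≤a+b = L , L-admissible , toStatement a b L identityᶠ
    where
    result : ∃ λ L → All (Admissible (a ℕ.+ b)) L × (S a K.* S b K.- S (a ℕ.+ b) ≃ combination L)
    result = productFormula (≡.subst (_≈ 0#) (natMul≡· (suc q') 1#) q·1≈0) (≡.subst (_≈ 0#) (natMul≡· p 1#) p·1≈0) a b 1≤a+b
    L : List (ℕ × ℕ)
    L = proj₁ result
    L-admissible : All (Admissible (a ℕ.+ b)) L
    L-admissible = proj₁ (proj₂ result)
    identityᶠ : S₁ᶠ a ⊛ S₁ᶠ b ⊕ ⊝ S₁ᶠ (a ℕ.+ b) ≃ combinationᶠ L
    identityᶠ = K.trans (K.+-cong (K.*-cong (S₁ᶠ≃S a) (S₁ᶠ≃S b)) (K.-‿cong (S₁ᶠ≃S (a ℕ.+ b))))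
                        (K.trans (proj₂ (proj₂ result)) (combination≃ L))

prime-power-≥2 : ∀ {p} n → Prime p → 2 ≤ p ℕ.^ suc n
prime-power-≥2 {p} n p-prime =
  ℕ.*-mono-≤ (ℕ.nonTrivial⇒n>1 p {{prime⇒nonTrivial p-prime}}) (ℕ.m^n>0 p {{prime⇒nonZero p-prime}} n)

-- The field has q = p^n ≥ 2 elements; write q = q' + 1 and apply DegreeOneProducts
-- (only a + b ≥ 1 is needed, not 1 ≤ b).
mainTheorem1 : ∀ {c ℓ} (R : CommutativeRing c ℓ) (p n q : ℕ) → Prime p → 1 ≤ n → q ≡ p ℕ.^ n
    → (F : IsFiniteField R q)
    → CommutativeRing._≈_ R (natMul R p (CommutativeRing.1# R)) (CommutativeRing.0# R)
    → (a b : ℕ) → 1 ≤ a → 1 ≤ b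
    → ∃ λ (L : List (ℕ × ℕ))
      → All (λ x → proj₁ x < p × 1 ≤ proj₂ x × (+ (q ∸ 1)) ∣ℤ ((+ (a ℕ.+ b)) -ℤ (+ proj₂ x))) L
        × _≈f_ R (_+f_ R (_*f_ R (S₁ R (IsFiniteField.enum F) a) (S₁ R (IsFiniteField.enum F) b))
                         (negᶠ R (S₁ R (IsFiniteField.enum F) (a ℕ.+ b))))
                 (linComb R (IsFiniteField.enum F) L)
mainTheorem1 R p (suc n) zero             p-prime (s≤s z≤n) q≡p^n =
  contradiction (≡.subst (2 ≤_) (≡.sym q≡p^n) (prime-power-≥2 n p-prime)) λ ()
mainTheorem1 R p (suc n) (suc zero)       p-prime (s≤s z≤n) q≡p^n =
  contradiction (≡.subst (2 ≤_) (≡.sym q≡p^n) (prime-power-≥2 n p-prime)) λ { (s≤s ()) }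
mainTheorem1 R p (suc n) q@(suc (suc _))  p-prime (s≤s z≤n) q≡p^n F p·1≈0 a b 1≤a _ =
  DegreeOneProducts.theorem R (q ∸ 1) F p {{prime⇒nonZero p-prime}}
    (NaturalMultiples.power-char R p n q q≡p^n p·1≈0) p·1≈0 a b (ℕ.≤-trans 1≤a (ℕ.m≤m+n a b))
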